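{- Let $O_n$ be the number of one-sided weak rectangulations of size $n$ (equivalently, the number of permutations of $[n]$ avoiding the four vincular patterns $2\underline{41}3$, $2\underline{14}3$, $3\underline{41}2$, $3\underline{14}2$). Then $\limsup_{n\to\infty}O_n^{1/n}\le \frac12(7+\sqrt{17})\approx 5.562$.
   Context: A rectangulation of an axis-aligned rectangle $R$ is a decomposition into finitely many interior-disjoint axis-aligned rectangles; size = number of rectangles; generic (no point is a corner of four rectangles). A segment is a maximal straight line segment that is a union of rectangle sides and not contained in a side of $R$; the neighbors of a segment $s$ are the segments perpendicular to $s$ with an endpoint on $s$ (each lying on one of the two sides of $s$). $r$ is on the left of $r'$ if there is a sequence $r=r^1,\dots,r^k=r'$ with the right side of $r^i$ and left side of $r^{i+1}$ in a common segment; $r$ is below $r'$ analogously with top and bottom sides. Two rectangulations are weakly equivalent if there is a bijection between their rectangles preserving the on-the-left and below relations; a weak rectangulation is an equivalence class. A weak rectangulation is one-sided if every segment has no neighbors on at least one of its two sides. An occurrence of a vincular pattern is an order-isomorphic subsequence in which entries corresponding to underlined adjacent letters are at adjacent positions. -}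

module Defs where

open import Data.Nat using (ℕ; zero; suc; _<_; _≤_; _*_; _^_; _∸_; _+_)
open import Data.Nat.Properties using () renaming (_≟_ to _≟ℕ_)
open import Data.Fin using (Fin; toℕ) renaming (_<_ to _<ᶠ_)
open import Data.Fin.Properties using (any?; all?) renaming (_<?_ to _<ᶠ?_; _≟_ to _≟ᶠ_)
open import Data.Vec using (Vec; []; _∷_; lookup)
open import Data.List using (List; [_]; concatMap; map; filter; length)
open import Data.List.Base using (allFin)
open import Data.Product using (∃; Σ; _×_; _,_)
open import Relation.Binary.PropositionalEquality using (_≡_)
open import Relation.Nullary using (¬_; Dec)
open import Relation.Nullary.Decidable using (_×-dec_; _→-dec_; ¬?)
import Data.Nat.Properties as ℕP

-- A permutation of [n] in one-line notation: a vector π of length n with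
-- entries in Fin n (π(i) = lookup π i) that is injective.
IsPerm : ∀ {n} → Vec (Fin n) n → Set
IsPerm {n} π = (i j : Fin n) → lookup π i ≡ lookup π j → i ≡ j

isPerm? : ∀ {n} (π : Vec (Fin n) n) → Dec (IsPerm π)
isPerm? π = all? λ i → all? λ j → (lookup π i ≟ᶠ lookup π j) →-dec (i ≟ᶠ j)

_⟨_<_⟩ : ∀ {n} → Vec (Fin n) n → Fin n → Fin n → Set
π ⟨ a < b ⟩ = lookup π a <ᶠ lookup π b

-- Occurrences of the four vincular patterns: positions i < j, k = j+1, k < l
-- (entries at j, j+1 adjacent), with values order-isomorphic to the pattern.
-- 2 41 3 : π(k) < π(i) < π(l) < π(j)
-- 2 14 3 : π(j) < π(i) < π(l) < π(k)
-- 3 41 2 : π(k) < π(l) < π(i) < π(j)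
-- 3 14 2 : π(j) < π(l) < π(i) < π(k)
Positions : ∀ {n} → Fin n → Fin n → Fin n → Fin n → Set
Positions i j k l = (i <ᶠ j) × (toℕ k ≡ suc (toℕ j)) × (k <ᶠ l)

Occ2413 Occ2143 Occ3412 Occ3142 : ∀ {n} → Vec (Fin n) n → Set
Occ2413 π = ∃ λ i → ∃ λ j → ∃ λ k → ∃ λ l →
  Positions i j k l × π ⟨ k < i ⟩ × π ⟨ i < l ⟩ × π ⟨ l < j ⟩
Occ2143 π = ∃ λ i → ∃ λ j → ∃ λ k → ∃ λ l →
  Positions i j k l × π ⟨ j < i ⟩ × π ⟨ i < l ⟩ × π ⟨ l < k ⟩
Occ3412 π = ∃ λ i → ∃ λ j → ∃ λ k → ∃ λ l →
  Positions i j k l × π ⟨ k < l ⟩ × π ⟨ l < i ⟩ × π ⟨ i < j ⟩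
Occ3142 π = ∃ λ i → ∃ λ j → ∃ λ k → ∃ λ l →
  Positions i j k l × π ⟨ j < l ⟩ × π ⟨ l < i ⟩ × π ⟨ i < k ⟩

positions? : ∀ {n} (i j k l : Fin n) → Dec (Positions i j k l)
positions? i j k l = (i <ᶠ? j) ×-dec ((toℕ k ≟ℕ suc (toℕ j)) ×-dec (k <ᶠ? l))

lt? : ∀ {n} (π : Vec (Fin n) n) a b → Dec (π ⟨ a < b ⟩)
lt? π a b = lookup π a <ᶠ? lookup π b

occ2413? : ∀ {n} (π : Vec (Fin n) n) → Dec (Occ2413 π)
occ2413? π = any? λ i → any? λ j → any? λ k → any? λ l →
  positions? i j k l ×-dec lt? π k i ×-dec lt? π i l ×-dec lt? π l j
occ2143? : ∀ {n} (π : Vec (Fin n) n) → Dec (Occ2143 π)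
occ2143? π = any? λ i → any? λ j → any? λ k → any? λ l →
  positions? i j k l ×-dec lt? π j i ×-dec lt? π i l ×-dec lt? π l k
occ3412? : ∀ {n} (π : Vec (Fin n) n) → Dec (Occ3412 π)
occ3412? π = any? λ i → any? λ j → any? λ k → any? λ l →
  positions? i j k l ×-dec lt? π k l ×-dec lt? π l i ×-dec lt? π i j
occ3142? : ∀ {n} (π : Vec (Fin n) n) → Dec (Occ3142 π)
occ3142? π = any? λ i → any? λ j → any? λ k → any? λ l →
  positions? i j k l ×-dec lt? π j l ×-dec lt? π l i ×-dec lt? π i k

Avoids : ∀ {n} → Vec (Fin n) n → Set
Avoids π = ¬ Occ2413 π × ¬ Occ2143 π × ¬ Occ3412 π × ¬ Occ3142 π

avoids? : ∀ {n} (π : Vec (Fin n) n) → Dec (Avoids π)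
avoids? π = ¬? (occ2413? π) ×-dec ¬? (occ2143? π) ×-dec ¬? (occ3412? π) ×-dec ¬? (occ3142? π)

allVecs : (n k : ℕ) → List (Vec (Fin n) k)
allVecs n zero = [ [] ]
allVecs n (suc k) = concatMap (λ x → map (x ∷_) (allVecs n k)) (allFin n)

O : ℕ → ℕ
O n = length (filter (λ π → isPerm? π ×-dec avoids? π) (allVecs n n))

-- The positive rational a/b (b > 0) exceeds (7 + √17)/2, i.e.
-- 2a − 7b > 0 and (2a − 7b)² > 17 b².
AboveBound : ℕ → ℕ → Set
AboveBound a b = (0 < b) × (7 * b < 2 * a) × (17 * (b ^ 2) < (2 * a ∸ 7 * b) ^ 2)

-- A permutation of [n + 1] avoiding the four patterns is its first entry g prepended to a
-- pattern-avoiding permutation ρ of [n], and g must lie in a gap of ρ that is not blocked,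
-- i.e. not straddled by two adjacent entries of ρ with a later entry between them. Weigh ρ
-- by 2^(number of free gaps), times A or B according to whether both gaps beside its first
-- entry are free. Prepending g adds at most one free gap, and prepending g far from the
-- first entry of ρ blocks every gap in between; a geometric sum over the free gaps then
-- shows that the children of ρ weigh at most c/d times ρ, provided A, B, c, d satisfy three
-- linear inequalities. These can be met whenever c ≥ 3d and 7cd ≤ c² + 8d², i.e. for
-- c/d ≥ (7 + √17)/2, the larger root of x² − 7x + 8. The total weight bounds O n and grows
-- at most like (c/d)^n; taking c/d strictly below a/b, Bernoulli's inequality absorbs the
-- constant factor.

module Submission where

open import Defs
open import Data.Nat using (ℕ; _≤_; _*_; _^_)
open import Data.Product using (∃; _×_)

open import Data.Nat using (zero; suc; pred; _+_; _∸_; _<_; z≤n; s≤s; _≤?_; _<?_; NonZero; >-nonZero)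
open import Data.Nat.Properties
open import Data.Nat.Tactic.RingSolver using (solve-∀)
import Data.Fin.Properties as Fin
open import Data.Fin using (Fin; zero; suc; toℕ; fromℕ<; punchIn; punchOut)
open import Data.Vec as Vec using (Vec; _∷_; lookup)
import Data.Vec.Properties as Vec
open import Data.List using (List; []; _∷_; _++_; map; concatMap; filter; length; allFin; tabulate)
open import Data.Product using (_,_)
open import Data.Sum using (_⊎_; inj₁; inj₂; [_,_]′)
open import Relation.Nullary using (¬_; Dec; yes; no; contradiction)
open import Relation.Nullary.Decidable using (_×-dec_; _⊎-dec_)
open import Relation.Unary using (Decidable)
open import Relation.Binary.PropositionalEquality
open import Relation.Binary.Definitions using (tri<; tri≈; tri>)
open import Function using (_∘_)
open import Algebra.Properties.CommutativeSemigroup +-commutativeSemigroup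
  using (interchange; xy∙z≈xz∙y)
open import Algebra.Properties.CommutativeSemigroup *-commutativeSemigroup
  using (x∙yz≈y∙xz; xy∙z≈y∙xz)
open import Algebra.Properties.CommutativeMonoid.Sum +-0-commutativeMonoid
  using (sum; sum-cong-≗; sum-remove; sum-replicate-zero)

private variable X Y : Set

when : {P : Set} → Dec P → ℕ → ℕ
when (yes _) x = x
when (no _)  _ = 0

infix 9 sumOver
sumOver : List X → (X → ℕ) → ℕ
sumOver []       f = 0
sumOver (x ∷ xs) f = f x + sumOver xs f

syntax sumOver xs (λ x → e) = ∑[ x ∈ xs ] e

∑-cong : ∀ (xs : List X) {f g : X → ℕ} → (∀ a → f a ≡ g a) → sumOver xs f ≡ sumOver xs g
∑-cong []       f≗g = refl
∑-cong (x ∷ xs) f≗g = cong₂ _+_ (f≗g x) (∑-cong xs f≗g)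

∑-mono-≤ : ∀ (xs : List X) {f g : X → ℕ} → (∀ a → f a ≤ g a) → sumOver xs f ≤ sumOver xs g
∑-mono-≤ []       f≤g = z≤n
∑-mono-≤ (x ∷ xs) f≤g = +-mono-≤ (f≤g x) (∑-mono-≤ xs f≤g)

∑-zero : ∀ (xs : List X) → sumOver xs (λ _ → 0) ≡ 0
∑-zero []       = refl
∑-zero (x ∷ xs) = ∑-zero xs

∑-distrib-+ : ∀ (xs : List X) (f g : X → ℕ) →
  ∑[ a ∈ xs ] (f a + g a) ≡ sumOver xs f + sumOver xs g
∑-distrib-+ []       f g = refl
∑-distrib-+ (x ∷ xs) f g = begin
  f x + g x + ∑[ a ∈ xs ] (f a + g a)        ≡⟨ cong (f x + g x +_) (∑-distrib-+ xs f g) ⟩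
  f x + g x + (sumOver xs f + sumOver xs g)  ≡⟨ interchange (f x) (g x) _ _ ⟩
  f x + sumOver xs f + (g x + sumOver xs g)  ∎
  where open ≡-Reasoning

∑-*ˡ : ∀ (xs : List X) c (f : X → ℕ) → ∑[ a ∈ xs ] (c * f a) ≡ c * sumOver xs f
∑-*ˡ []       c f = sym (*-zeroʳ c)
∑-*ˡ (x ∷ xs) c f = trans (cong (c * f x +_) (∑-*ˡ xs c f)) (sym (*-distribˡ-+ c (f x) _))

∑-++ : ∀ (xs ys : List X) f → sumOver (xs ++ ys) f ≡ sumOver xs f + sumOver ys f
∑-++ []       ys f = refl
∑-++ (x ∷ xs) ys f = trans (cong (f x +_) (∑-++ xs ys f)) (sym (+-assoc (f x) _ _))

∑-tabulate : ∀ n (g : Fin n → X) f → sumOver (tabulate g) f ≡ sum (f ∘ g)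
∑-tabulate zero    g f = refl
∑-tabulate (suc n) g f = cong (f (g zero) +_) (∑-tabulate n (g ∘ suc) f)

sum-∑-comm : ∀ {n} (xs : List X) (f : Fin n → X → ℕ) →
  sum (λ i → sumOver xs (f i)) ≡ ∑[ a ∈ xs ] sum (λ i → f i a)
sum-∑-comm {n = zero}  xs f = sym (∑-zero xs)
sum-∑-comm {n = suc n} xs f = trans (cong (sumOver xs (f zero) +_) (sum-∑-comm xs (f ∘ suc)))
  (sym (∑-distrib-+ xs (f zero) (λ a → sum (λ i → f (suc i) a))))

length-filter≤∑ : ∀ {P : X → Set} (P? : Decidable P) (xs : List X) (w : X → ℕ) → (∀ a → 1 ≤ w a) →
  length (filter P? xs) ≤ ∑[ a ∈ xs ] when (P? a) (w a)
length-filter≤∑ P? []       w 1≤w = z≤n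
length-filter≤∑ P? (x ∷ xs) w 1≤w with P? x
... | yes _ = +-mono-≤ (1≤w x) (length-filter≤∑ P? xs w 1≤w)
... | no  _ = length-filter≤∑ P? xs w 1≤w

∑-map : ∀ (g : X → Y) (xs : List X) f → sumOver (map g xs) f ≡ sumOver xs (f ∘ g)
∑-map g []       f = refl
∑-map g (x ∷ xs) f = cong (f (g x) +_) (∑-map g xs f)

∑-concatMap : ∀ (g : X → List Y) (xs : List X) f →
  sumOver (concatMap g xs) f ≡ ∑[ a ∈ xs ] sumOver (g a) f
∑-concatMap g []       f = refl
∑-concatMap g (x ∷ xs) f =
  trans (∑-++ (g x) (concatMap g xs) f) (cong (sumOver (g x) f +_) (∑-concatMap g xs f))

sum-mono-≤ : ∀ {n} {f g : Fin n → ℕ} → (∀ i → f i ≤ g i) → sum f ≤ sum g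
sum-mono-≤ {zero}  f≤g = z≤n
sum-mono-≤ {suc n} f≤g = +-mono-≤ (f≤g zero) (sum-mono-≤ (f≤g ∘ suc))

∑-allVecs-suc : ∀ n k (F : Vec (Fin n) (suc k) → ℕ) →
  sumOver (allVecs n (suc k)) F ≡ sum (λ x → ∑[ v ∈ allVecs n k ] F (x ∷ v))
∑-allVecs-suc n k F = begin
  sumOver (allVecs n (suc k)) F
    ≡⟨ ∑-concatMap _ (allFin n) F ⟩
  ∑[ x ∈ allFin n ] sumOver (map (x ∷_) (allVecs n k)) F
    ≡⟨ ∑-cong (allFin n) (λ x → ∑-map (x ∷_) (allVecs n k) F) ⟩
  ∑[ x ∈ allFin n ] ∑[ v ∈ allVecs n k ] F (x ∷ v)
    ≡⟨ ∑-tabulate n _ _ ⟩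
  sum (λ x → ∑[ v ∈ allVecs n k ] F (x ∷ v)) ∎
  where open ≡-Reasoning

∑-allVecs-punchIn : ∀ m k (x : Fin (suc m)) (F : Vec (Fin (suc m)) k → ℕ) →
  (∀ v i → lookup v i ≡ x → F v ≡ 0) →
  sumOver (allVecs (suc m) k) F ≡ ∑[ v ∈ allVecs m k ] F (Vec.map (punchIn x) v)
∑-allVecs-punchIn m zero    x F F-x = refl
∑-allVecs-punchIn m (suc k) x F F-x = begin
  sumOver (allVecs (suc m) (suc k)) F
    ≡⟨ ∑-allVecs-suc (suc m) k F ⟩
  sum (λ y → ∑[ v ∈ allVecs (suc m) k ] F (y ∷ v))
    ≡⟨ sum-remove {i = x} (λ y → ∑[ v ∈ allVecs (suc m) k ] F (y ∷ v)) ⟩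
  ∑[ v ∈ allVecs (suc m) k ] F (x ∷ v) + sum (λ y → ∑[ v ∈ allVecs (suc m) k ] F (punchIn x y ∷ v))
    ≡⟨ cong₂ _+_ (trans (∑-cong (allVecs (suc m) k) (λ v → F-x (x ∷ v) zero refl)) (∑-zero (allVecs (suc m) k)))
                 (sum-cong-≗ λ y → ∑-allVecs-punchIn m k x (λ v → F (punchIn x y ∷ v))
                                      (λ v i → F-x (punchIn x y ∷ v) (suc i))) ⟩
  sum (λ y → ∑[ v ∈ allVecs m k ] F (punchIn x y ∷ Vec.map (punchIn x) v))
    ≡⟨ ∑-allVecs-suc m k (F ∘ Vec.map (punchIn x)) ⟨
  ∑[ v ∈ allVecs m (suc k) ] F (Vec.map (punchIn x) v)
    ∎
  where open ≡-Reasoning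

sumFrom : (ℕ → ℕ) → ℕ → ℕ → ℕ
sumFrom f lo zero    = 0
sumFrom f lo (suc n) = f lo + sumFrom f (suc lo) n

infix 9 ∑[_⋯_⟩_
∑[_⋯_⟩_ : ℕ → ℕ → (ℕ → ℕ) → ℕ
∑[ lo ⋯ hi ⟩ f = sumFrom f lo (hi ∸ lo)

sumFrom-+ : ∀ f m n lo → sumFrom f lo (m + n) ≡ sumFrom f lo m + sumFrom f (lo + m) n
sumFrom-+ f zero    n lo = cong (λ lo′ → sumFrom f lo′ n) (sym (+-identityʳ lo))
sumFrom-+ f (suc m) n lo = begin
  f lo + sumFrom f (suc lo) (m + n)
    ≡⟨ cong (f lo +_) (sumFrom-+ f m n (suc lo)) ⟩
  f lo + (sumFrom f (suc lo) m + sumFrom f (suc lo + m) n)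
    ≡⟨ sym (+-assoc (f lo) _ _) ⟩
  f lo + sumFrom f (suc lo) m + sumFrom f (suc lo + m) n
    ≡⟨ cong (λ k → f lo + sumFrom f (suc lo) m + sumFrom f k n) (sym (+-suc lo m)) ⟩
  f lo + sumFrom f (suc lo) m + sumFrom f (lo + suc m) n ∎
  where open ≡-Reasoning

∑⋯-split : ∀ f {lo mid hi} → lo ≤ mid → mid ≤ hi →
  ∑[ lo ⋯ hi ⟩ f ≡ ∑[ lo ⋯ mid ⟩ f + ∑[ mid ⋯ hi ⟩ f
∑⋯-split f {lo} {mid} {hi} lo≤mid mid≤hi = begin
  sumFrom f lo (hi ∸ lo)
    ≡⟨ cong (sumFrom f lo) hi∸lo ⟩
  sumFrom f lo ((mid ∸ lo) + (hi ∸ mid))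
    ≡⟨ sumFrom-+ f (mid ∸ lo) (hi ∸ mid) lo ⟩
  ∑[ lo ⋯ mid ⟩ f + sumFrom f (lo + (mid ∸ lo)) (hi ∸ mid)
    ≡⟨ cong (λ k → ∑[ lo ⋯ mid ⟩ f + sumFrom f k (hi ∸ mid)) (m+[n∸m]≡n lo≤mid) ⟩
  ∑[ lo ⋯ mid ⟩ f + ∑[ mid ⋯ hi ⟩ f ∎
  where
  open ≡-Reasoning
  hi∸lo : hi ∸ lo ≡ (mid ∸ lo) + (hi ∸ mid)
  hi∸lo = begin
    hi ∸ lo                     ≡⟨ cong (_∸ lo) (sym (m+[n∸m]≡n mid≤hi)) ⟩
    mid + (hi ∸ mid) ∸ lo       ≡⟨ +-∸-comm (hi ∸ mid) lo≤mid ⟩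
    (mid ∸ lo) + (hi ∸ mid)     ∎

∑⋯-singleton : ∀ f lo → ∑[ lo ⋯ suc lo ⟩ f ≡ f lo
∑⋯-singleton f lo = begin
  sumFrom f lo (suc lo ∸ lo) ≡⟨ cong (sumFrom f lo) (trans (+-∸-assoc 1 (≤-refl {lo})) (cong suc (n∸n≡0 lo))) ⟩
  f lo + 0                   ≡⟨ +-identityʳ (f lo) ⟩
  f lo                       ∎
  where open ≡-Reasoning

∑⋯-head : ∀ f {lo hi} → lo < hi → ∑[ lo ⋯ hi ⟩ f ≡ f lo + ∑[ suc lo ⋯ hi ⟩ f
∑⋯-head f {lo} {hi} lo<hi =
  trans (∑⋯-split f (n≤1+n lo) lo<hi) (cong (_+ ∑[ suc lo ⋯ hi ⟩ f) (∑⋯-singleton f lo))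

∑⋯-last : ∀ f {lo hi} → lo ≤ hi → ∑[ lo ⋯ suc hi ⟩ f ≡ ∑[ lo ⋯ hi ⟩ f + f hi
∑⋯-last f {lo} {hi} lo≤hi =
  trans (∑⋯-split f lo≤hi (n≤1+n hi)) (cong (∑[ lo ⋯ hi ⟩ f +_) (∑⋯-singleton f hi))

sumFrom-mono-≤ : ∀ {f g} n lo → (∀ i → lo ≤ i → i < lo + n → f i ≤ g i) → sumFrom f lo n ≤ sumFrom g lo n
sumFrom-mono-≤ zero    lo f≤g = z≤n
sumFrom-mono-≤ (suc n) lo f≤g = +-mono-≤
  (f≤g lo ≤-refl (subst (lo <_) (sym (+-suc lo n)) (s≤s (m≤m+n lo n))))
  (sumFrom-mono-≤ n (suc lo) λ i lo<i i<lo+n → f≤g i (<⇒≤ lo<i) (subst (i <_) (sym (+-suc lo n)) i<lo+n))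

∑⋯-mono-≤ : ∀ {f g lo hi} → lo ≤ hi → (∀ i → lo ≤ i → i < hi → f i ≤ g i) →
  ∑[ lo ⋯ hi ⟩ f ≤ ∑[ lo ⋯ hi ⟩ g
∑⋯-mono-≤ {lo = lo} {hi} lo≤hi f≤g =
  sumFrom-mono-≤ (hi ∸ lo) lo λ i lo≤i i<hi → f≤g i lo≤i (subst (i <_) (m+[n∸m]≡n lo≤hi) i<hi)

∑⋯-cong : ∀ {f g lo hi} → lo ≤ hi → (∀ i → lo ≤ i → i < hi → f i ≡ g i) →
  ∑[ lo ⋯ hi ⟩ f ≡ ∑[ lo ⋯ hi ⟩ g
∑⋯-cong lo≤hi f≡g = ≤-antisym
  (∑⋯-mono-≤ lo≤hi λ i lo≤i i<hi → ≤-reflexive (f≡g i lo≤i i<hi))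
  (∑⋯-mono-≤ lo≤hi λ i lo≤i i<hi → ≤-reflexive (sym (f≡g i lo≤i i<hi)))

∑⋯-zero : ∀ {f lo hi} → lo ≤ hi → (∀ i → lo ≤ i → i < hi → f i ≡ 0) → ∑[ lo ⋯ hi ⟩ f ≡ 0
∑⋯-zero {lo = lo} {hi} lo≤hi f≡0 = trans (∑⋯-cong lo≤hi f≡0) (zeros (hi ∸ lo) lo)
  where
  zeros : ∀ n lo → sumFrom (λ _ → 0) lo n ≡ 0
  zeros zero    lo = refl
  zeros (suc n) lo = zeros n (suc lo)

∑⋯-skip : ∀ f {lo a b hi} → lo ≤ a → a ≤ b → b ≤ hi → (∀ i → a ≤ i → i < b → f i ≡ 0) →
  ∑[ lo ⋯ hi ⟩ f ≡ ∑[ lo ⋯ a ⟩ f + ∑[ b ⋯ hi ⟩ f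
∑⋯-skip f {lo} {a} {b} {hi} lo≤a a≤b b≤hi f≡0 = begin
  ∑[ lo ⋯ hi ⟩ f
    ≡⟨ ∑⋯-split f lo≤a (≤-trans a≤b b≤hi) ⟩
  ∑[ lo ⋯ a ⟩ f + ∑[ a ⋯ hi ⟩ f
    ≡⟨ cong (∑[ lo ⋯ a ⟩ f +_) (∑⋯-split f a≤b b≤hi) ⟩
  ∑[ lo ⋯ a ⟩ f + (∑[ a ⋯ b ⟩ f + ∑[ b ⋯ hi ⟩ f)
    ≡⟨ cong (λ x → ∑[ lo ⋯ a ⟩ f + (x + ∑[ b ⋯ hi ⟩ f)) (∑⋯-zero a≤b f≡0) ⟩
  ∑[ lo ⋯ a ⟩ f + ∑[ b ⋯ hi ⟩ f ∎
  where open ≡-Reasoning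

∑⋯-pair : ∀ f lo → ∑[ lo ⋯ suc (suc lo) ⟩ f ≡ f lo + f (suc lo)
∑⋯-pair f lo = trans (∑⋯-head f (s≤s (n≤1+n lo))) (cong (f lo +_) (∑⋯-singleton f (suc lo)))

∑⋯-pred : ∀ f lo hi → ∑[ suc lo ⋯ suc hi ⟩ (f ∘ pred) ≡ ∑[ lo ⋯ hi ⟩ f
∑⋯-pred f lo hi = go (hi ∸ lo) lo
  where
  go : ∀ n lo → sumFrom (f ∘ pred) (suc lo) n ≡ sumFrom f lo n
  go zero    lo = refl
  go (suc n) lo = cong (f lo +_) (go n (suc lo))

∑⋯-*ˡ : ∀ c f lo hi → ∑[ lo ⋯ hi ⟩ (λ h → c * f h) ≡ c * ∑[ lo ⋯ hi ⟩ f
∑⋯-*ˡ c f lo hi = go (hi ∸ lo) lo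
  where
  go : ∀ n lo → sumFrom (λ h → c * f h) lo n ≡ c * sumFrom f lo n
  go zero    lo = sym (*-zeroʳ c)
  go (suc n) lo = trans (cong (c * f lo +_) (go n (suc lo))) (sym (*-distribˡ-+ c (f lo) _))

sum≡∑⋯ : ∀ n (f : ℕ → ℕ) → sum (f ∘ toℕ {n}) ≡ ∑[ 0 ⋯ n ⟩ f
sum≡∑⋯ n f = go n 0
  where
  go : ∀ n lo → sum (λ (i : Fin n) → f (lo + toℕ i)) ≡ sumFrom f lo n
  go zero    lo = refl
  go (suc n) lo = cong₂ _+_ (cong f (+-identityʳ lo))
    (trans (sum-cong-≗ {n} {λ i → f (lo + suc (toℕ i))} {λ i → f (suc lo + toℕ i)}
                       λ i → cong f (+-suc lo (toℕ i)))
           (go n (suc lo)))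

IsBit : ℕ → Set
IsBit x = x ≡ 0 ⊎ x ≡ 1

bit-doubling : ∀ {s} → IsBit s → ∀ c → s * 2 ^ (s + c) + 2 ^ suc c ≡ 2 ^ suc (s + c)
bit-doubling (inj₁ refl) c = refl
bit-doubling (inj₂ refl) c = trans (cong (_+ 2 ^ suc c) (*-identityˡ (2 ^ suc c)))
  (cong (2 ^ suc c +_) (sym (+-identityʳ (2 ^ suc c))))

geometric-prefix : ∀ {f} → (∀ i → IsBit (f i)) → ∀ r →
  ∑[ 0 ⋯ r ⟩ (λ h → f h * 2 ^ ∑[ 0 ⋯ suc h ⟩ f) + 2 ≡ 2 ^ suc (∑[ 0 ⋯ r ⟩ f)
geometric-prefix bit zero = refl
geometric-prefix {f} bit (suc r) = begin
  ∑[ 0 ⋯ suc r ⟩ F + 2                 ≡⟨ cong (_+ 2) (∑⋯-last F z≤n) ⟩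
  ∑[ 0 ⋯ r ⟩ F + F r + 2               ≡⟨ xy∙z≈xz∙y (∑[ 0 ⋯ r ⟩ F) (F r) 2 ⟩
  ∑[ 0 ⋯ r ⟩ F + 2 + F r               ≡⟨ cong (_+ F r) (geometric-prefix bit r) ⟩
  2 ^ suc c + F r                      ≡⟨ +-comm (2 ^ suc c) (F r) ⟩
  f r * 2 ^ ∑[ 0 ⋯ suc r ⟩ f + 2 ^ suc c ≡⟨ cong (λ e → f r * 2 ^ e + 2 ^ suc c) ∑≡ ⟩
  f r * 2 ^ (f r + c) + 2 ^ suc c      ≡⟨ bit-doubling (bit r) c ⟩
  2 ^ suc (f r + c)                    ≡⟨ cong (λ e → 2 ^ suc e) (sym ∑≡) ⟩
  2 ^ suc (∑[ 0 ⋯ suc r ⟩ f)           ∎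
  where
  open ≡-Reasoning
  F : ℕ → ℕ
  F = λ h → f h * 2 ^ ∑[ 0 ⋯ suc h ⟩ f
  c : ℕ
  c = ∑[ 0 ⋯ r ⟩ f
  ∑≡ : ∑[ 0 ⋯ suc r ⟩ f ≡ f r + c
  ∑≡ = trans (∑⋯-last f z≤n) (+-comm c (f r))

geometric-suffix : ∀ {f} → (∀ i → IsBit (f i)) → ∀ lo hi →
  ∑[ lo ⋯ hi ⟩ (λ h → f h * 2 ^ ∑[ h ⋯ hi ⟩ f) + 2 ≡ 2 ^ suc (∑[ lo ⋯ hi ⟩ f)
geometric-suffix {f} bit lo hi = go lo (hi ∸ lo) refl
  where
  F : ℕ → ℕ
  F = λ h → f h * 2 ^ ∑[ h ⋯ hi ⟩ f
  go : ∀ lo n → hi ∸ lo ≡ n → ∑[ lo ⋯ hi ⟩ F + 2 ≡ 2 ^ suc (∑[ lo ⋯ hi ⟩ f)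
  go lo zero    hi∸lo≡0 rewrite hi∸lo≡0 = refl
  go lo (suc n) hi∸lo≡1+n = begin
    ∑[ lo ⋯ hi ⟩ F + 2                    ≡⟨ cong (_+ 2) (∑⋯-head F lo<hi) ⟩
    F lo + ∑[ suc lo ⋯ hi ⟩ F + 2         ≡⟨ +-assoc (F lo) _ 2 ⟩
    F lo + (∑[ suc lo ⋯ hi ⟩ F + 2)       ≡⟨ cong (F lo +_) (go (suc lo) n hi∸1+lo≡n) ⟩
    f lo * 2 ^ ∑[ lo ⋯ hi ⟩ f + 2 ^ suc c ≡⟨ cong (λ e → f lo * 2 ^ e + 2 ^ suc c) ∑≡ ⟩
    f lo * 2 ^ (f lo + c) + 2 ^ suc c     ≡⟨ bit-doubling (bit lo) c ⟩
    2 ^ suc (f lo + c)                    ≡⟨ cong (λ e → 2 ^ suc e) (sym ∑≡) ⟩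
    2 ^ suc (∑[ lo ⋯ hi ⟩ f)              ∎
    where
    open ≡-Reasoning
    lo<hi : lo < hi
    lo<hi = m∸n≢0⇒n<m (λ hi∸lo≡0 → 0≢1+n (trans (sym hi∸lo≡0) hi∸lo≡1+n))
    hi∸1+lo≡n : hi ∸ suc lo ≡ n
    hi∸1+lo≡n = trans (sym (pred[m∸n]≡m∸[1+n] hi lo)) (cong pred hi∸lo≡1+n)
    c : ℕ
    c = ∑[ suc lo ⋯ hi ⟩ f
    ∑≡ : ∑[ lo ⋯ hi ⟩ f ≡ f lo + c
    ∑≡ = ∑⋯-head f lo<hi

Between : ℕ → ℕ → ℕ → Set
Between p q r = (p < r × r < q) ⊎ (q < r × r < p)

-- Gap h of a permutation of [m] (0 ≤ h ≤ m) is the slot just below the value h; a new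
-- entry inserted there receives the value h and pushes the values ≥ h up by one.
GapBetween : ℕ → ℕ → ℕ → Set
GapBetween p q h = (p < h × h ≤ q) ⊎ (q < h × h ≤ p)

data PunchInView (G v : ℕ) : ℕ → Set where
  below : v < G → PunchInView G v v
  above : G ≤ v → PunchInView G v (suc v)

punchInView-suc : ∀ {G v w} → PunchInView G v w → PunchInView (suc G) (suc v) (suc w)
punchInView-suc (below v<G) = below (s≤s v<G)
punchInView-suc (above G≤v) = above (s≤s G≤v)

toℕ-punchIn : ∀ {m} (g : Fin (suc m)) (v : Fin m) → PunchInView (toℕ g) (toℕ v) (toℕ (punchIn g v))
toℕ-punchIn zero    v       = above z≤n
toℕ-punchIn (suc g) zero    = below (s≤s z≤n)
toℕ-punchIn (suc g) (suc v) = punchInView-suc (toℕ-punchIn g v)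

module _ {G : ℕ} where

  punchInView-< : ∀ {v w} → PunchInView G v w → v < G → w ≡ v
  punchInView-< (below _)   _   = refl
  punchInView-< (above G≤v) v<G = contradiction v<G (≤⇒≯ G≤v)

  punchInView-≥ : ∀ {v w} → PunchInView G v w → G ≤ v → w ≡ suc v
  punchInView-≥ (above _)   _   = refl
  punchInView-≥ (below v<G) G≤v = contradiction v<G (≤⇒≯ G≤v)

  punchInView-mono-< : ∀ {a a′ b b′} → PunchInView G a a′ → PunchInView G b b′ → a < b → a′ < b′
  punchInView-mono-< (below _)   (below _)   a<b = a<b
  punchInView-mono-< (below _)   (above _)   a<b = m<n⇒m<1+n a<b
  punchInView-mono-< (above G≤a) (below b<G) a<b = contradiction (<-trans a<b b<G) (≤⇒≯ G≤a)
  punchInView-mono-< (above _)   (above _)   a<b = s≤s a<b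

  punchInView-between : ∀ {p p′ q q′ r r′} → PunchInView G p p′ → PunchInView G q q′ → PunchInView G r r′ →
    Between p q r → Between p′ q′ r′
  punchInView-between vp vq vr (inj₁ (p<r , r<q)) = inj₁ (punchInView-mono-< vp vr p<r , punchInView-mono-< vr vq r<q)
  punchInView-between vp vq vr (inj₂ (q<r , r<p)) = inj₂ (punchInView-mono-< vq vr q<r , punchInView-mono-< vr vp r<p)

  private
    gap-≤ : ∀ {p p′ q q′ h} → PunchInView G p p′ → PunchInView G q q′ → h ≤ G →
      p < h × h ≤ q → p′ < h × h ≤ q′
    gap-≤ (below _)   (below _) _   (p<h , h≤q) = p<h , h≤q
    gap-≤ (below _)   (above _) _   (p<h , h≤q) = p<h , m≤n⇒m≤1+n h≤q
    gap-≤ (above G≤p) _         h≤G (p<h , _)   = contradiction (≤-trans h≤G G≤p) (<⇒≱ p<h)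

    gap-≥ : ∀ {p p′ q q′ h} → PunchInView G p p′ → PunchInView G q q′ → ¬ (p < G × G ≤ q) → G ≤ h →
      p < h × h ≤ q → p′ < suc h × suc h ≤ q′
    gap-≥ (below p<G) _           G∉ G≤h (_ , h≤q)   = contradiction (p<G , ≤-trans G≤h h≤q) G∉
    gap-≥ (above _)   (below q<G) _  G≤h (_ , h≤q)   = contradiction (≤-trans G≤h h≤q) (<⇒≱ q<G)
    gap-≥ (above _)   (above _)   _  _   (p<h , h≤q) = s≤s p<h , s≤s h≤q

  punchInView-gap-≤ : ∀ {p p′ q q′ h} → PunchInView G p p′ → PunchInView G q q′ → h ≤ G →
    GapBetween p q h → GapBetween p′ q′ h
  punchInView-gap-≤ vp vq h≤G (inj₁ gap) = inj₁ (gap-≤ vp vq h≤G gap)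
  punchInView-gap-≤ vp vq h≤G (inj₂ gap) = inj₂ (gap-≤ vq vp h≤G gap)

  punchInView-gap-≥ : ∀ {p p′ q q′ h} → PunchInView G p p′ → PunchInView G q q′ → ¬ GapBetween p q G → G ≤ h →
    GapBetween p q h → GapBetween p′ q′ (suc h)
  punchInView-gap-≥ vp vq G∉ G≤h (inj₁ gap) = inj₁ (gap-≥ vp vq (G∉ ∘ inj₁) G≤h gap)
  punchInView-gap-≥ vp vq G∉ G≤h (inj₂ gap) = inj₂ (gap-≥ vq vp (G∉ ∘ inj₂) G≤h gap)

  private
    straddle : ∀ {p p′ q q′ r r′} → PunchInView G p p′ → PunchInView G q q′ → PunchInView G r r′ →
      p < r × r < q → p < G × G ≤ q → (p′ < r′ × r′ < G × G < q′) ⊎ (p′ < G × G < r′ × r′ < q′)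
    straddle (below _)   (above _)   (below r<G) (p<r , _)   (_ , G≤q) = inj₁ (p<r , r<G , s≤s G≤q)
    straddle (below _)   (above _)   (above G≤r) (_ , r<q)   (p<G , _) = inj₂ (p<G , s≤s G≤r , s≤s r<q)
    straddle (above G≤p) _           _           _           (p<G , _) = contradiction p<G (≤⇒≯ G≤p)
    straddle (below _)   (below q<G) _           _           (_ , G≤q) = contradiction q<G (≤⇒≯ G≤q)

  punchInView-pattern : ∀ {p p′ q q′ r r′} → PunchInView G p p′ → PunchInView G q q′ → PunchInView G r r′ →
    Between p q r → GapBetween p q G →
    ((p′ < r′ × r′ < G × G < q′) ⊎ (p′ < G × G < r′ × r′ < q′)) ⊎
    ((q′ < r′ × r′ < G × G < p′) ⊎ (q′ < G × G < r′ × r′ < p′))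
  punchInView-pattern vp vq vr (inj₁ btw) (inj₁ gap) = inj₁ (straddle vp vq vr btw gap)
  punchInView-pattern vp vq vr (inj₂ btw) (inj₂ gap) = inj₂ (straddle vq vp vr btw gap)
  punchInView-pattern _ _ _ (inj₁ (p<r , r<q)) (inj₂ (q<G , G≤p)) =
    contradiction (<-trans p<r r<q) (<⇒≯ (<-≤-trans q<G G≤p))
  punchInView-pattern _ _ _ (inj₂ (q<r , r<p)) (inj₁ (p<G , G≤q)) =
    contradiction (<-trans q<r r<p) (<⇒≯ (<-≤-trans p<G G≤q))

val : ∀ {m n} → Vec (Fin m) n → Fin n → ℕ
val ρ i = toℕ (lookup ρ i)

-- A new first entry placed in a blocked gap would complete one of the four patterns
-- together with the adjacent pair (j, k) and the later entry l.
Blocked : ∀ {m n} → Vec (Fin m) n → ℕ → Set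
Blocked {n = n} ρ h = ∃ λ (j : Fin n) → ∃ λ (k : Fin n) → ∃ λ (l : Fin n) →
  toℕ k ≡ suc (toℕ j) × toℕ k < toℕ l ×
  Between (val ρ j) (val ρ k) (val ρ l) × GapBetween (val ρ j) (val ρ k) h

opaque
  blocked? : ∀ {m n} (ρ : Vec (Fin m) n) h → Dec (Blocked ρ h)
  blocked? ρ h = Fin.any? λ j → Fin.any? λ k → Fin.any? λ l →
    toℕ k ≟ suc (toℕ j) ×-dec toℕ k <? toℕ l ×-dec between? _ _ _ ×-dec gapBetween? _ _ h
    where
    between? : ∀ p q r → Dec (Between p q r)
    between? p q r = (p <? r ×-dec r <? q) ⊎-dec (q <? r ×-dec r <? p)
    gapBetween? : ∀ p q h → Dec (GapBetween p q h)
    gapBetween? p q h = (p <? h ×-dec h ≤? q) ⊎-dec (q <? h ×-dec h ≤? p)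

prepend : ∀ {m} → Fin (suc m) → Vec (Fin m) m → Vec (Fin (suc m)) (suc m)
prepend g ρ = g ∷ Vec.map (punchIn g) ρ

module _ {m} (g : Fin (suc m)) (ρ : Vec (Fin m) m) where

  private
    π : Vec (Fin (suc m)) (suc m)
    π = prepend g ρ

  val-prepend : ∀ i → PunchInView (toℕ g) (val ρ i) (val π (suc i))
  val-prepend i rewrite Vec.lookup-map i (punchIn g) ρ = toℕ-punchIn g (lookup ρ i)

  blocked-prepend-≤ : ∀ {h} → h ≤ toℕ g → Blocked ρ h → Blocked π h
  blocked-prepend-≤ h≤g (j , k , l , k≡1+j , k<l , btw , gap) =
    suc j , suc k , suc l , cong suc k≡1+j , s≤s k<l ,
    punchInView-between (val-prepend j) (val-prepend k) (val-prepend l) btw ,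
    punchInView-gap-≤ (val-prepend j) (val-prepend k) h≤g gap

  blocked-prepend-≥ : ∀ {h} → toℕ g ≤ h → ¬ Blocked ρ (toℕ g) → Blocked ρ h → Blocked π (suc h)
  blocked-prepend-≥ g≤h g-free (j , k , l , k≡1+j , k<l , btw , gap) =
    suc j , suc k , suc l , cong suc k≡1+j , s≤s k<l ,
    punchInView-between (val-prepend j) (val-prepend k) (val-prepend l) btw ,
    punchInView-gap-≥ (val-prepend j) (val-prepend k)
      (λ gap′ → g-free (j , k , l , k≡1+j , k<l , btw , gap′)) g≤h gap

  avoids-prepend⇒¬blocked : Avoids π → ¬ Blocked ρ (toℕ g)
  avoids-prepend⇒¬blocked (¬2413 , ¬2143 , ¬3412 , ¬3142) (j , k , l , k≡1+j , k<l , btw , gap) =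
    [ [ (λ o → ¬3142 (zero , suc j , suc k , suc l , positions , o))
      , (λ o → ¬2143 (zero , suc j , suc k , suc l , positions , o)) ]′
    , [ (λ o → ¬3412 (zero , suc j , suc k , suc l , positions , o))
      , (λ o → ¬2413 (zero , suc j , suc k , suc l , positions , o)) ]′
    ]′ (punchInView-pattern (val-prepend j) (val-prepend k) (val-prepend l) btw gap)
    where
    positions : Positions zero (suc j) (suc k) (suc l)
    positions = s≤s z≤n , cong suc k≡1+j , s≤s k<l

  avoids-prepend⇒avoids : Avoids π → Avoids ρ
  avoids-prepend⇒avoids (¬2413 , ¬2143 , ¬3412 , ¬3142) =
    (λ (i , j , k , l , ps , x , y , z) → ¬2413 (suc i , suc j , suc k , suc l , lift ps , mono k i x , mono i l y , mono l j z)) ,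
    (λ (i , j , k , l , ps , x , y , z) → ¬2143 (suc i , suc j , suc k , suc l , lift ps , mono j i x , mono i l y , mono l k z)) ,
    (λ (i , j , k , l , ps , x , y , z) → ¬3412 (suc i , suc j , suc k , suc l , lift ps , mono k l x , mono l i y , mono i j z)) ,
    (λ (i , j , k , l , ps , x , y , z) → ¬3142 (suc i , suc j , suc k , suc l , lift ps , mono j l x , mono l i y , mono i k z))
    where
    lift : ∀ {i j k l} → Positions i j k l → Positions (suc i) (suc j) (suc k) (suc l)
    lift (i<j , k≡1+j , k<l) = s≤s i<j , cong suc k≡1+j , s≤s k<l
    mono : ∀ a b → ρ ⟨ a < b ⟩ → π ⟨ suc a < suc b ⟩
    mono a b = punchInView-mono-< (val-prepend a) (val-prepend b)

  isPerm-prepend⇒isPerm : IsPerm π → IsPerm ρ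
  isPerm-prepend⇒isPerm π-inj i j ρi≡ρj = Fin.suc-injective (π-inj (suc i) (suc j) (begin
    lookup (Vec.map (punchIn g) ρ) i ≡⟨ Vec.lookup-map i (punchIn g) ρ ⟩
    punchIn g (lookup ρ i)           ≡⟨ cong (punchIn g) ρi≡ρj ⟩
    punchIn g (lookup ρ j)           ≡⟨ Vec.lookup-map j (punchIn g) ρ ⟨
    lookup (Vec.map (punchIn g) ρ) j ∎))
    where open ≡-Reasoning

isPerm-∷⇒∉ : ∀ {k} {x : Fin (suc k)} {v : Vec (Fin (suc k)) k} → IsPerm (x ∷ v) → ∀ i → lookup v i ≢ x
isPerm-∷⇒∉ x∷v-inj i vi≡x with x∷v-inj zero (suc i) (sym vi≡x)
... | ()

isPerm⇒surjective : ∀ {m} (ρ : Vec (Fin m) m) → IsPerm ρ → ∀ v → ∃ λ l → lookup ρ l ≡ v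
isPerm⇒surjective {suc m} ρ ρ-inj v with Fin.any? (λ l → lookup ρ l Fin.≟ v)
... | yes hit  = hit
... | no  miss = contradiction (Fin.injective⇒≤ punchOut∘ρ-injective) 1+n≰n
  where
  ρ≢v : ∀ l → v ≢ lookup ρ l
  ρ≢v l v≡ρl = miss (l , sym v≡ρl)
  punchOut∘ρ-injective : ∀ {a b} → punchOut (ρ≢v a) ≡ punchOut (ρ≢v b) → a ≡ b
  punchOut∘ρ-injective eq = ρ-inj _ _ (Fin.punchOut-injective (ρ≢v _) (ρ≢v _) eq)

isPerm⇒val-surjective : ∀ {m} (ρ : Vec (Fin m) m) → IsPerm ρ → ∀ {V} → V < m → ∃ λ l → val ρ l ≡ V
isPerm⇒val-surjective ρ ρ-inj V<m with isPerm⇒surjective ρ ρ-inj (fromℕ< V<m)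
... | l , ρl≡V = l , trans (cong toℕ ρl≡V) (Fin.toℕ-fromℕ< V<m)

-- Prepending an entry far from the head of ρ blocks every gap between the two: the first
-- two entries of the result form an adjacent pair straddling an entry further right.
module _ {m} (g : Fin (suc (suc m))) (ρ : Vec (Fin (suc m)) (suc m)) (ρ-perm : IsPerm ρ) where

  private
    π : Vec (Fin (suc (suc m))) (suc (suc m))
    π = prepend g ρ
    G : ℕ
    G = toℕ g
    r : ℕ
    r = val ρ zero

  blocked-prepend-below-head : G < r → ∀ {h} → G < h → h ≤ suc r → Blocked π h
  blocked-prepend-below-head G<r {h} G<h h≤1+r
    with isPerm⇒val-surjective ρ ρ-perm (<-trans G<r (Fin.toℕ<n (lookup ρ zero)))
  ... | zero  , r≡G = contradiction r≡G (≢-sym (<⇒≢ G<r))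
  ... | suc l , ρl≡G =
    zero , suc zero , suc (suc l) , refl , s≤s (s≤s z≤n) ,
    inj₁ (subst (G <_) (sym πl≡1+G) ≤-refl , subst₂ _<_ (sym πl≡1+G) (sym π1≡1+r) (s≤s G<r)) ,
    inj₁ (G<h , subst (h ≤_) (sym π1≡1+r) h≤1+r)
    where
    π1≡1+r : val π (suc zero) ≡ suc r
    π1≡1+r = punchInView-≥ (val-prepend g ρ zero) (<⇒≤ G<r)
    πl≡1+G : val π (suc (suc l)) ≡ suc G
    πl≡1+G = trans (punchInView-≥ (val-prepend g ρ (suc l)) (≤-reflexive (sym ρl≡G))) (cong suc ρl≡G)

  blocked-prepend-above-head : suc r < G → ∀ {h} → r < h → h ≤ G → Blocked π h
  blocked-prepend-above-head 1+r<G {h} r<h h≤G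
    with isPerm⇒val-surjective ρ ρ-perm (<-≤-trans 1+r<G (Fin.toℕ≤pred[n] g))
  ... | zero  , r≡1+r = contradiction r≡1+r (<⇒≢ (n<1+n r))
  ... | suc l , ρl≡1+r =
    zero , suc zero , suc (suc l) , refl , s≤s (s≤s z≤n) ,
    inj₂ (subst₂ _<_ (sym π1≡r) (sym πl≡1+r) ≤-refl , subst (_< G) (sym πl≡1+r) 1+r<G) ,
    inj₂ (subst (_< h) (sym π1≡r) r<h , h≤G)
    where
    π1≡r : val π (suc zero) ≡ r
    π1≡r = punchInView-< (val-prepend g ρ zero) (<-trans (n<1+n r) 1+r<G)
    πl≡1+r : val π (suc (suc l)) ≡ suc r
    πl≡1+r = trans (punchInView-< (val-prepend g ρ (suc l)) (subst (_< G) (sym ρl≡1+r) 1+r<G)) ρl≡1+r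

free : ∀ {m n} → Vec (Fin m) n → ℕ → ℕ
free ρ h with blocked? ρ h
... | yes _ = 0
... | no  _ = 1

freeGaps : ∀ {m} → Vec (Fin m) m → ℕ
freeGaps {m} ρ = ∑[ 0 ⋯ suc m ⟩ free ρ

module _ {m n} (ρ : Vec (Fin m) n) where

  free-blocked : ∀ {h} → Blocked ρ h → free ρ h ≡ 0
  free-blocked {h} blocked with blocked? ρ h
  ... | yes _        = refl
  ... | no  ¬blocked = contradiction blocked ¬blocked

  free-unblocked : ∀ {h} → ¬ Blocked ρ h → free ρ h ≡ 1
  free-unblocked {h} ¬blocked with blocked? ρ h
  ... | yes blocked = contradiction blocked ¬blocked
  ... | no  _       = refl

  free-isBit : ∀ h → IsBit (free ρ h)
  free-isBit h with blocked? ρ h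
  ... | yes _ = inj₁ refl
  ... | no  _ = inj₂ refl

  free≤1 : ∀ h → free ρ h ≤ 1
  free≤1 h with blocked? ρ h
  ... | yes _ = z≤n
  ... | no  _ = ≤-refl

free-antitone : ∀ {m n m′ n′} (ρ : Vec (Fin m) n) (π : Vec (Fin m′) n′) {h h′} →
  (Blocked ρ h′ → Blocked π h) → free π h ≤ free ρ h′
free-antitone ρ π {h} {h′} blocks with blocked? ρ h′
... | yes blocked = ≤-reflexive (free-blocked π (blocks blocked))
... | no  _       = free≤1 π h

module _ {m} (g : Fin (suc m)) (ρ : Vec (Fin m) m) (g-free : ¬ Blocked ρ (toℕ g)) where

  private
    π : Vec (Fin (suc m)) (suc m)
    π = prepend g ρ
    G : ℕ
    G = toℕ g
    G≤m : G ≤ m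
    G≤m = Fin.toℕ≤pred[n] g

  ∑free-prepend-below : ∀ {u} → u ≤ suc G → ∑[ 0 ⋯ u ⟩ free π ≤ ∑[ 0 ⋯ u ⟩ free ρ
  ∑free-prepend-below u≤1+G = ∑⋯-mono-≤ z≤n λ h _ h<u →
    free-antitone ρ π (blocked-prepend-≤ g ρ (≤-pred (≤-trans h<u u≤1+G)))

  ∑free-prepend-above : ∀ {u} → G ≤ u → u ≤ suc m →
    ∑[ suc u ⋯ suc (suc m) ⟩ free π ≤ ∑[ u ⋯ suc m ⟩ free ρ
  ∑free-prepend-above {u} G≤u u≤1+m = begin
    ∑[ suc u ⋯ suc (suc m) ⟩ free π          ≤⟨ ∑⋯-mono-≤ (s≤s u≤1+m) shifted ⟩
    ∑[ suc u ⋯ suc (suc m) ⟩ (free ρ ∘ pred) ≡⟨ ∑⋯-pred (free ρ) u (suc m) ⟩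
    ∑[ u ⋯ suc m ⟩ free ρ                    ∎
    where
    open ≤-Reasoning
    shifted : ∀ h → suc u ≤ h → h < suc (suc m) → free π h ≤ free ρ (pred h)
    shifted (suc h) (s≤s u≤h) _ = free-antitone ρ π (blocked-prepend-≥ g ρ (≤-trans G≤u u≤h) g-free)

  freeGaps-prepend : freeGaps π ≤ suc (freeGaps ρ)
  freeGaps-prepend = begin
    freeGaps π
      ≡⟨ ∑⋯-split (free π) z≤n (s≤s (m≤n⇒m≤1+n G≤m)) ⟩
    ∑[ 0 ⋯ suc G ⟩ free π + ∑[ suc G ⋯ suc (suc m) ⟩ free π
      ≤⟨ +-mono-≤ (∑free-prepend-below ≤-refl) (∑free-prepend-above ≤-refl (m≤n⇒m≤1+n G≤m)) ⟩
    ∑[ 0 ⋯ suc G ⟩ free ρ + ∑[ G ⋯ suc m ⟩ free ρ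
      ≡⟨ cong (_+ ∑[ G ⋯ suc m ⟩ free ρ) (∑⋯-last (free ρ) z≤n) ⟩
    ∑[ 0 ⋯ G ⟩ free ρ + free ρ G + ∑[ G ⋯ suc m ⟩ free ρ
      ≡⟨ cong (λ x → ∑[ 0 ⋯ G ⟩ free ρ + x + ∑[ G ⋯ suc m ⟩ free ρ) (free-unblocked ρ g-free) ⟩
    ∑[ 0 ⋯ G ⟩ free ρ + 1 + ∑[ G ⋯ suc m ⟩ free ρ
      ≡⟨ cong (_+ ∑[ G ⋯ suc m ⟩ free ρ) (+-comm (∑[ 0 ⋯ G ⟩ free ρ) 1) ⟩
    suc (∑[ 0 ⋯ G ⟩ free ρ + ∑[ G ⋯ suc m ⟩ free ρ)
      ≡⟨ cong suc (∑⋯-split (free ρ) z≤n (m≤n⇒m≤1+n G≤m)) ⟨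
    suc (freeGaps ρ) ∎
    where open ≤-Reasoning

module _ {m} (g : Fin (suc (suc m))) (ρ : Vec (Fin (suc m)) (suc m)) (ρ-perm : IsPerm ρ)
         (g-free : ¬ Blocked ρ (toℕ g)) where

  private
    π : Vec (Fin (suc (suc m))) (suc (suc m))
    π = prepend g ρ
    G : ℕ
    G = toℕ g
    G≤1+m : G ≤ suc m
    G≤1+m = Fin.toℕ≤pred[n] g
    r : ℕ
    r = val ρ zero
    r≤m : r ≤ m
    r≤m = ≤-pred (Fin.toℕ<n (lookup ρ zero))
    1+r≤2+m : suc r ≤ suc (suc m)
    1+r≤2+m = s≤s (m≤n⇒m≤1+n r≤m)

  freeGaps-prepend-below-head : G < r → freeGaps π ≤ ∑[ 0 ⋯ suc G ⟩ free ρ + ∑[ suc r ⋯ suc (suc m) ⟩ free ρ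
  freeGaps-prepend-below-head G<r = begin
    freeGaps π
      ≡⟨ ∑⋯-skip (free π) z≤n (s≤s G≤1+r) (s≤s 1+r≤2+m) blocked-between ⟩
    ∑[ 0 ⋯ suc G ⟩ free π + ∑[ suc (suc r) ⋯ suc (suc (suc m)) ⟩ free π
      ≤⟨ +-mono-≤ (∑free-prepend-below g ρ g-free ≤-refl) (∑free-prepend-above g ρ g-free G≤1+r 1+r≤2+m) ⟩
    ∑[ 0 ⋯ suc G ⟩ free ρ + ∑[ suc r ⋯ suc (suc m) ⟩ free ρ ∎
    where
    open ≤-Reasoning
    G≤1+r : G ≤ suc r
    G≤1+r = m≤n⇒m≤1+n (<⇒≤ G<r)
    blocked-between : ∀ h → suc G ≤ h → h < suc (suc r) → free π h ≡ 0
    blocked-between h G<h h<2+r = free-blocked π (blocked-prepend-below-head g ρ ρ-perm G<r G<h (≤-pred h<2+r))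

  freeGaps-prepend-above-head : suc r < G → freeGaps π ≤ ∑[ 0 ⋯ suc r ⟩ free ρ + ∑[ G ⋯ suc (suc m) ⟩ free ρ
  freeGaps-prepend-above-head 1+r<G = begin
    freeGaps π
      ≡⟨ ∑⋯-skip (free π) z≤n 1+r≤1+G (s≤s G≤2+m) blocked-between ⟩
    ∑[ 0 ⋯ suc r ⟩ free π + ∑[ suc G ⋯ suc (suc (suc m)) ⟩ free π
      ≤⟨ +-mono-≤ (∑free-prepend-below g ρ g-free 1+r≤1+G) (∑free-prepend-above g ρ g-free ≤-refl G≤2+m) ⟩
    ∑[ 0 ⋯ suc r ⟩ free ρ + ∑[ G ⋯ suc (suc m) ⟩ free ρ ∎
    where
    open ≤-Reasoning
    1+r≤1+G : suc r ≤ suc G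
    1+r≤1+G = <⇒≤ (m<n⇒m<1+n 1+r<G)
    G≤2+m : G ≤ suc (suc m)
    G≤2+m = m≤n⇒m≤1+n G≤1+m
    blocked-between : ∀ h → suc r ≤ h → h < suc G → free π h ≡ 0
    blocked-between h r<h h≤G = free-blocked π (blocked-prepend-above-head g ρ ρ-perm 1+r<G r<h (≤-pred h≤G))

  free-prepend-below-head : G < r → free π (suc G) ≡ 0
  free-prepend-below-head G<r = free-blocked π (blocked-prepend-below-head g ρ ρ-perm G<r ≤-refl (s≤s (<⇒≤ G<r)))

  free-prepend-above-head : suc r < G → free π G ≡ 0
  free-prepend-above-head 1+r<G = free-blocked π (blocked-prepend-above-head g ρ ρ-perm 1+r<G (<⇒≤ 1+r<G) ≤-refl)

module Weights (A B : ℕ) where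

  headWeight : ℕ → ℕ → ℕ
  headWeight (suc _) (suc _) = A
  headWeight _       _       = B

  -- The two arguments of headWeight say whether the gaps just below and just above the
  -- first entry are free; only there can a prepended entry avoid blocking a run of gaps.
  weight : ∀ {m} → Vec (Fin m) m → ℕ
  weight {zero}  _ = 1
  weight {suc m} ρ = headWeight (free ρ (val ρ zero)) (free ρ (suc (val ρ zero))) * 2 ^ freeGaps ρ

  headWeight≤A : B ≤ A → ∀ x y → headWeight x y ≤ A
  headWeight≤A B≤A (suc _) (suc _) = ≤-refl
  headWeight≤A B≤A zero    _       = B≤A
  headWeight≤A B≤A (suc _) zero    = B≤A

  headWeight-0ʳ : ∀ x → headWeight x 0 ≡ B
  headWeight-0ʳ zero    = refl
  headWeight-0ʳ (suc _) = refl

  module _ {m} (g : Fin (suc (suc m))) (ρ : Vec (Fin (suc m)) (suc m)) (ρ-perm : IsPerm ρ)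
           (g-free : ¬ Blocked ρ (toℕ g)) where

    private
      π : Vec (Fin (suc (suc m))) (suc (suc m))
      π = prepend g ρ
      G : ℕ
      G = toℕ g
      r : ℕ
      r = val ρ zero

    weight-prepend : B ≤ A → weight π ≤ A * 2 ^ suc (freeGaps ρ)
    weight-prepend B≤A = *-mono-≤ (headWeight≤A B≤A (free π G) (free π (suc G)))
                                  (^-monoʳ-≤ 2 (freeGaps-prepend g ρ g-free))

    weight-prepend-below-head : G < r →
      weight π ≤ B * 2 ^ (∑[ 0 ⋯ suc G ⟩ free ρ + ∑[ suc r ⋯ suc (suc m) ⟩ free ρ)
    weight-prepend-below-head G<r = *-mono-≤
      (≤-reflexive (trans (cong (headWeight (free π G)) (free-prepend-below-head g ρ ρ-perm g-free G<r))
                          (headWeight-0ʳ (free π G))))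
      (^-monoʳ-≤ 2 (freeGaps-prepend-below-head g ρ ρ-perm g-free G<r))

    weight-prepend-above-head : suc r < G →
      weight π ≤ B * 2 ^ (∑[ 0 ⋯ suc r ⟩ free ρ + ∑[ G ⋯ suc (suc m) ⟩ free ρ)
    weight-prepend-above-head 1+r<G = *-mono-≤
      (≤-reflexive (cong (λ x → headWeight x (free π (suc G))) (free-prepend-above-head g ρ ρ-perm g-free 1+r<G)))
      (^-monoʳ-≤ 2 (freeGaps-prepend-above-head g ρ ρ-perm g-free 1+r<G))

  headBudget : ℕ → ℕ → ℕ
  headBudget s t = B * 2 ^ suc t + ((s + t) * (A * 2 ^ suc (s + t)) + B * 2 ^ suc s)

  module _ {m} (ρ : Vec (Fin (suc m)) (suc m)) (ρ-perm : IsPerm ρ) (B≤A : B ≤ A) where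

    private
      r : ℕ
      r = val ρ zero
      f : ℕ → ℕ
      f = free ρ
      P : ℕ
      P = ∑[ 0 ⋯ r ⟩ f
      s : ℕ
      s = f r
      t : ℕ
      t = f (suc r)
      Q : ℕ
      Q = ∑[ suc (suc r) ⋯ suc (suc m) ⟩ f
      r≤m : r ≤ m
      r≤m = ≤-pred (Fin.toℕ<n (lookup ρ zero))

      childBound : ℕ → ℕ
      childBound h with <-cmp h r
      ... | tri< _ _ _ = B * 2 ^ (∑[ 0 ⋯ suc h ⟩ f + ∑[ suc r ⋯ suc (suc m) ⟩ f)
      ... | tri≈ _ _ _ = A * 2 ^ suc (freeGaps ρ)
      ... | tri> _ _ _ with h ≟ suc r
      ...   | yes _ = A * 2 ^ suc (freeGaps ρ)
      ...   | no  _ = B * 2 ^ (∑[ 0 ⋯ suc r ⟩ f + ∑[ h ⋯ suc (suc m) ⟩ f)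

      childBound-< : ∀ {h} → h < r → childBound h ≡ B * 2 ^ (∑[ 0 ⋯ suc h ⟩ f + ∑[ suc r ⋯ suc (suc m) ⟩ f)
      childBound-< {h} h<r with <-cmp h r
      ... | tri< _ _ _    = refl
      ... | tri≈ ¬h<r _ _ = contradiction h<r ¬h<r
      ... | tri> ¬h<r _ _ = contradiction h<r ¬h<r

      childBound-head : childBound r ≡ A * 2 ^ suc (freeGaps ρ)
      childBound-head with <-cmp r r
      ... | tri< _ r≢r _ = contradiction refl r≢r
      ... | tri≈ _ _ _   = refl
      ... | tri> _ r≢r _ = contradiction refl r≢r

      childBound-suc-head : childBound (suc r) ≡ A * 2 ^ suc (freeGaps ρ)
      childBound-suc-head with <-cmp (suc r) r
      ... | tri< 1+r<r _ _ = contradiction 1+r<r (<-asym (n<1+n r))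
      ... | tri≈ _ 1+r≡r _ = contradiction 1+r≡r 1+n≢n
      ... | tri> _ _ _ with suc r ≟ suc r
      ...   | yes _        = refl
      ...   | no 1+r≢1+r   = contradiction refl 1+r≢1+r

      childBound-> : ∀ {h} → suc r < h → childBound h ≡ B * 2 ^ (∑[ 0 ⋯ suc r ⟩ f + ∑[ h ⋯ suc (suc m) ⟩ f)
      childBound-> {h} 1+r<h with <-cmp h r
      ... | tri< h<r _ _ = contradiction (<-trans (n<1+n r) 1+r<h) (<-asym h<r)
      ... | tri≈ _ h≡r _ = contradiction (<-trans (n<1+n r) 1+r<h) (<-irrefl (sym h≡r))
      ... | tri> _ _ _ with h ≟ suc r
      ...   | yes h≡1+r = contradiction h≡1+r (>⇒≢ 1+r<h)
      ...   | no  _     = refl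

      weight-prepend≤childBound : ∀ g → ¬ Blocked ρ (toℕ g) → weight (prepend g ρ) ≤ childBound (toℕ g)
      weight-prepend≤childBound g g-free with <-cmp (toℕ g) r
      ... | tri< G<r _ _ = weight-prepend-below-head g ρ ρ-perm g-free G<r
      ... | tri≈ _ _ _   = weight-prepend g ρ ρ-perm g-free B≤A
      ... | tri> _ _ r<G with toℕ g ≟ suc r
      ...   | yes _      = weight-prepend g ρ ρ-perm g-free B≤A
      ...   | no G≢1+r   = weight-prepend-above-head g ρ ρ-perm g-free (≤∧≢⇒< r<G (≢-sym G≢1+r))

      childTerm : ℕ → ℕ
      childTerm h = f h * childBound h

      childWeight≤childTerm : ∀ g → f (toℕ g) * weight (prepend g ρ) ≤ childTerm (toℕ g)
      childWeight≤childTerm g with blocked? ρ (toℕ g)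
      ... | yes _      = z≤n
      ... | no  g-free = *-monoʳ-≤ 1 (weight-prepend≤childBound g g-free)

      factor-2^ʳ : ∀ x a b → x * (B * 2 ^ (a + b)) ≡ B * 2 ^ b * (x * 2 ^ a)
      factor-2^ʳ x a b = trans (cong (λ e → x * (B * e)) (^-distribˡ-+-* 2 a b)) (shuffle x B (2 ^ a) (2 ^ b))
        where
        shuffle : ∀ x B u v → x * (B * (u * v)) ≡ B * v * (x * u)
        shuffle = solve-∀

      factor-2^ˡ : ∀ x a b → x * (B * 2 ^ (a + b)) ≡ B * 2 ^ a * (x * 2 ^ b)
      factor-2^ˡ x a b = trans (cong (λ e → x * (B * e)) (^-distribˡ-+-* 2 a b)) (shuffle x B (2 ^ a) (2 ^ b))
        where
        shuffle : ∀ x B u v → x * (B * (u * v)) ≡ B * u * (x * v)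
        shuffle = solve-∀

      ∑[1+r⋯]≡t+Q : ∑[ suc r ⋯ suc (suc m) ⟩ f ≡ t + Q
      ∑[1+r⋯]≡t+Q = ∑⋯-head f (s≤s (s≤s r≤m))

      ∑[⋯1+r]≡P+s : ∑[ 0 ⋯ suc r ⟩ f ≡ P + s
      ∑[⋯1+r]≡P+s = ∑⋯-last f z≤n

      freeGaps≡ : freeGaps ρ ≡ P + (s + (t + Q))
      freeGaps≡ = begin
        freeGaps ρ                       ≡⟨ ∑⋯-split f z≤n (m≤n⇒m≤1+n (m≤n⇒m≤1+n r≤m)) ⟩
        P + ∑[ r ⋯ suc (suc m) ⟩ f       ≡⟨ cong (P +_) (∑⋯-head f (s≤s (m≤n⇒m≤1+n r≤m))) ⟩
        P + (s + ∑[ suc r ⋯ suc (suc m) ⟩ f) ≡⟨ cong (λ x → P + (s + x)) ∑[1+r⋯]≡t+Q ⟩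
        P + (s + (t + Q))                ∎
        where open ≡-Reasoning

      2^freeGaps : 2 ^ freeGaps ρ ≡ 2 ^ P * (2 ^ s * (2 ^ t * 2 ^ Q))
      2^freeGaps = begin
        2 ^ freeGaps ρ                ≡⟨ cong (2 ^_) freeGaps≡ ⟩
        2 ^ (P + (s + (t + Q)))       ≡⟨ ^-distribˡ-+-* 2 P _ ⟩
        2 ^ P * 2 ^ (s + (t + Q))     ≡⟨ cong (2 ^ P *_) (^-distribˡ-+-* 2 s _) ⟩
        2 ^ P * (2 ^ s * 2 ^ (t + Q)) ≡⟨ cong (λ e → 2 ^ P * (2 ^ s * e)) (^-distribˡ-+-* 2 t Q) ⟩
        2 ^ P * (2 ^ s * (2 ^ t * 2 ^ Q)) ∎
        where open ≡-Reasoning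

      ∑childTerm-below-head : ∑[ 0 ⋯ r ⟩ childTerm ≤ 2 ^ P * 2 ^ Q * (B * 2 ^ suc t)
      ∑childTerm-below-head = begin
        ∑[ 0 ⋯ r ⟩ childTerm
          ≡⟨ ∑⋯-cong z≤n (λ h _ h<r → trans (cong (f h *_) (childBound-< h<r)) (factor-2^ʳ (f h) (∑[ 0 ⋯ suc h ⟩ f) R)) ⟩
        ∑[ 0 ⋯ r ⟩ (λ h → B * 2 ^ R * (f h * 2 ^ ∑[ 0 ⋯ suc h ⟩ f))
          ≡⟨ ∑⋯-*ˡ (B * 2 ^ R) (λ h → f h * 2 ^ ∑[ 0 ⋯ suc h ⟩ f) 0 r ⟩
        B * 2 ^ R * ∑[ 0 ⋯ r ⟩ (λ h → f h * 2 ^ ∑[ 0 ⋯ suc h ⟩ f)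
          ≤⟨ *-monoʳ-≤ (B * 2 ^ R) (≤-trans (m≤m+n _ 2) (≤-reflexive (geometric-prefix (free-isBit ρ) r))) ⟩
        B * 2 ^ R * 2 ^ suc P
          ≡⟨ cong (λ e → B * e * 2 ^ suc P) (trans (cong (2 ^_) ∑[1+r⋯]≡t+Q) (^-distribˡ-+-* 2 t Q)) ⟩
        B * (2 ^ t * 2 ^ Q) * (2 * 2 ^ P)
          ≡⟨ shuffle B (2 ^ t) (2 ^ Q) (2 ^ P) ⟩
        2 ^ P * 2 ^ Q * (B * 2 ^ suc t) ∎
        where
        open ≤-Reasoning
        R : ℕ
        R = ∑[ suc r ⋯ suc (suc m) ⟩ f
        shuffle : ∀ B x y z → B * (x * y) * (2 * z) ≡ z * y * (B * (2 * x))
        shuffle = solve-∀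

      ∑childTerm-above-head : ∑[ suc (suc r) ⋯ suc (suc m) ⟩ childTerm ≤ 2 ^ P * 2 ^ Q * (B * 2 ^ suc s)
      ∑childTerm-above-head = begin
        ∑[ suc (suc r) ⋯ suc (suc m) ⟩ childTerm
          ≡⟨ ∑⋯-cong 2+r≤2+m (λ h 1+r<h _ → trans (cong (f h *_) (childBound-> 1+r<h)) (factor-2^ˡ (f h) L (∑[ h ⋯ suc (suc m) ⟩ f))) ⟩
        ∑[ suc (suc r) ⋯ suc (suc m) ⟩ (λ h → B * 2 ^ L * (f h * 2 ^ ∑[ h ⋯ suc (suc m) ⟩ f))
          ≡⟨ ∑⋯-*ˡ (B * 2 ^ L) (λ h → f h * 2 ^ ∑[ h ⋯ suc (suc m) ⟩ f) (suc (suc r)) (suc (suc m)) ⟩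
        B * 2 ^ L * ∑[ suc (suc r) ⋯ suc (suc m) ⟩ (λ h → f h * 2 ^ ∑[ h ⋯ suc (suc m) ⟩ f)
          ≤⟨ *-monoʳ-≤ (B * 2 ^ L) (≤-trans (m≤m+n _ 2) (≤-reflexive (geometric-suffix (free-isBit ρ) (suc (suc r)) (suc (suc m))))) ⟩
        B * 2 ^ L * 2 ^ suc Q
          ≡⟨ cong (λ e → B * e * 2 ^ suc Q) (trans (cong (2 ^_) ∑[⋯1+r]≡P+s) (^-distribˡ-+-* 2 P s)) ⟩
        B * (2 ^ P * 2 ^ s) * (2 * 2 ^ Q)
          ≡⟨ shuffle B (2 ^ P) (2 ^ s) (2 ^ Q) ⟩
        2 ^ P * 2 ^ Q * (B * 2 ^ suc s) ∎
        where
        open ≤-Reasoning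
        L : ℕ
        L = ∑[ 0 ⋯ suc r ⟩ f
        2+r≤2+m : suc (suc r) ≤ suc (suc m)
        2+r≤2+m = s≤s (s≤s r≤m)
        shuffle : ∀ B x y z → B * (x * y) * (2 * z) ≡ x * z * (B * (2 * y))
        shuffle = solve-∀

      childTerm-head : childTerm r + childTerm (suc r) ≡ 2 ^ P * 2 ^ Q * ((s + t) * (A * 2 ^ suc (s + t)))
      childTerm-head = begin
        childTerm r + childTerm (suc r)
          ≡⟨ cong₂ (λ x y → s * x + t * y) childBound-head childBound-suc-head ⟩
        s * (A * 2 ^ suc (freeGaps ρ)) + t * (A * 2 ^ suc (freeGaps ρ))
          ≡⟨ cong (λ e → s * (A * (2 * e)) + t * (A * (2 * e))) 2^freeGaps ⟩
        s * (A * (2 * (2 ^ P * (2 ^ s * (2 ^ t * 2 ^ Q))))) + t * (A * (2 * (2 ^ P * (2 ^ s * (2 ^ t * 2 ^ Q)))))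
          ≡⟨ shuffle s t A (2 ^ P) (2 ^ s) (2 ^ t) (2 ^ Q) ⟩
        2 ^ P * 2 ^ Q * ((s + t) * (A * (2 * (2 ^ s * 2 ^ t))))
          ≡⟨ cong (λ e → 2 ^ P * 2 ^ Q * ((s + t) * (A * (2 * e)))) (^-distribˡ-+-* 2 s t) ⟨
        2 ^ P * 2 ^ Q * ((s + t) * (A * 2 ^ suc (s + t))) ∎
        where
        open ≡-Reasoning
        shuffle : ∀ s t A p σ τ q → s * (A * (2 * (p * (σ * (τ * q))))) + t * (A * (2 * (p * (σ * (τ * q)))))
                                    ≡ p * q * ((s + t) * (A * (2 * (σ * τ))))
        shuffle = solve-∀

      ∑childTerm≤ : ∑[ 0 ⋯ suc (suc m) ⟩ childTerm ≤ 2 ^ P * 2 ^ Q * headBudget s t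
      ∑childTerm≤ = begin
        ∑[ 0 ⋯ suc (suc m) ⟩ childTerm
          ≡⟨ ∑⋯-split childTerm z≤n (m≤n⇒m≤1+n (m≤n⇒m≤1+n r≤m)) ⟩
        ∑[ 0 ⋯ r ⟩ childTerm + ∑[ r ⋯ suc (suc m) ⟩ childTerm
          ≡⟨ cong (∑[ 0 ⋯ r ⟩ childTerm +_) (∑⋯-split childTerm (m≤n⇒m≤1+n (n≤1+n r)) (s≤s (s≤s r≤m))) ⟩
        ∑[ 0 ⋯ r ⟩ childTerm + (∑[ r ⋯ suc (suc r) ⟩ childTerm + rest)
          ≡⟨ cong (λ e → ∑[ 0 ⋯ r ⟩ childTerm + (e + rest)) (trans (∑⋯-pair childTerm r) childTerm-head) ⟩
        ∑[ 0 ⋯ r ⟩ childTerm + (x * ((s + t) * (A * 2 ^ suc (s + t))) + rest)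
          ≤⟨ +-mono-≤ ∑childTerm-below-head (+-monoʳ-≤ _ ∑childTerm-above-head) ⟩
        x * (B * 2 ^ suc t) + (x * ((s + t) * (A * 2 ^ suc (s + t))) + x * (B * 2 ^ suc s))
          ≡⟨ cong (x * (B * 2 ^ suc t) +_) (*-distribˡ-+ x _ _) ⟨
        x * (B * 2 ^ suc t) + x * ((s + t) * (A * 2 ^ suc (s + t)) + B * 2 ^ suc s)
          ≡⟨ *-distribˡ-+ x _ _ ⟨
        x * headBudget s t ∎
        where
        open ≤-Reasoning
        x rest : ℕ
        x = 2 ^ P * 2 ^ Q
        rest = ∑[ suc (suc r) ⋯ suc (suc m) ⟩ childTerm

      weight≡ : weight ρ ≡ 2 ^ P * 2 ^ Q * (headWeight s t * 2 ^ (s + t))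
      weight≡ = begin
        headWeight s t * 2 ^ freeGaps ρ
          ≡⟨ cong (headWeight s t *_) 2^freeGaps ⟩
        headWeight s t * (2 ^ P * (2 ^ s * (2 ^ t * 2 ^ Q)))
          ≡⟨ shuffle (headWeight s t) (2 ^ P) (2 ^ s) (2 ^ t) (2 ^ Q) ⟩
        2 ^ P * 2 ^ Q * (headWeight s t * (2 ^ s * 2 ^ t))
          ≡⟨ cong (λ e → 2 ^ P * 2 ^ Q * (headWeight s t * e)) (^-distribˡ-+-* 2 s t) ⟨
        2 ^ P * 2 ^ Q * (headWeight s t * 2 ^ (s + t)) ∎
        where
        open ≡-Reasoning
        shuffle : ∀ w p σ τ q → w * (p * (σ * (τ * q))) ≡ p * q * (w * (σ * τ))
        shuffle = solve-∀

    childrenWeight≤ : ∀ {c d} →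
      (∀ {s t} → IsBit s → IsBit t → d * headBudget s t ≤ c * (headWeight s t * 2 ^ (s + t))) →
      d * sum (λ g → free ρ (toℕ g) * weight (prepend g ρ)) ≤ c * weight ρ
    childrenWeight≤ {c} {d} budget = begin
      d * sum (λ g → f (toℕ g) * weight (prepend g ρ))  ≤⟨ *-monoʳ-≤ d (sum-mono-≤ childWeight≤childTerm) ⟩
      d * sum (childTerm ∘ toℕ {suc (suc m)})           ≡⟨ cong (d *_) (sum≡∑⋯ (suc (suc m)) childTerm) ⟩
      d * ∑[ 0 ⋯ suc (suc m) ⟩ childTerm                ≤⟨ *-monoʳ-≤ d ∑childTerm≤ ⟩
      d * (x * headBudget s t)                          ≡⟨ x∙yz≈y∙xz d x (headBudget s t) ⟩
      x * (d * headBudget s t)                          ≤⟨ *-monoʳ-≤ x (budget (free-isBit ρ r) (free-isBit ρ (suc r))) ⟩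
      x * (c * (headWeight s t * 2 ^ (s + t)))          ≡⟨ x∙yz≈y∙xz x c _ ⟩
      c * (x * (headWeight s t * 2 ^ (s + t)))          ≡⟨ cong (c *_) weight≡ ⟨
      c * weight ρ                                      ∎
      where
      open ≤-Reasoning
      x : ℕ
      x = 2 ^ P * 2 ^ Q

-- The inequalities make d · (weight of the children) ≤ c · weight hold whatever the state of
-- the two gaps around the first entry (both blocked, one free, both free), so that the
-- total weight grows at most by the factor c/d when the size increases by one.
record GrowthCertificate (A B c d : ℕ) : Set where
  field
    B≤A       : B ≤ A
    1≤B       : 1 ≤ B
    4d≤c      : 4 * d ≤ c
    one-free  : d * (2 * A + 3 * B) ≤ c * B
    both-free : d * (4 * A + 2 * B) ≤ c * A

module Growth {A B c d : ℕ} (cert : GrowthCertificate A B c d) where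

  open GrowthCertificate cert
  open Weights A B

  headBudget≤ : ∀ {s t} → IsBit s → IsBit t → d * headBudget s t ≤ c * (headWeight s t * 2 ^ (s + t))
  headBudget≤ (inj₁ refl) (inj₁ refl) = subst₂ _≤_ (lhs A B d) (rhs B c) (*-monoˡ-≤ B 4d≤c)
    where
    lhs : ∀ A B d → 4 * d * B ≡ d * (B * 2 + (0 * (A * 2) + B * 2))
    lhs = solve-∀
    rhs : ∀ B c → c * B ≡ c * (B * 1)
    rhs = solve-∀
  headBudget≤ (inj₂ refl) (inj₁ refl) = subst₂ _≤_ (lhs A B d) (rhs B c) (*-monoˡ-≤ 2 one-free)
    where
    lhs : ∀ A B d → d * (2 * A + 3 * B) * 2 ≡ d * (B * 2 + (1 * (A * 4) + B * 4))
    lhs = solve-∀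
    rhs : ∀ B c → c * B * 2 ≡ c * (B * 2)
    rhs = solve-∀
  headBudget≤ (inj₁ refl) (inj₂ refl) = subst₂ _≤_ (lhs A B d) (rhs B c) (*-monoˡ-≤ 2 one-free)
    where
    lhs : ∀ A B d → d * (2 * A + 3 * B) * 2 ≡ d * (B * 4 + (1 * (A * 4) + B * 2))
    lhs = solve-∀
    rhs : ∀ B c → c * B * 2 ≡ c * (B * 2)
    rhs = solve-∀
  headBudget≤ (inj₂ refl) (inj₂ refl) = subst₂ _≤_ (lhs A B d) (rhs A c) (*-monoˡ-≤ 4 both-free)
    where
    lhs : ∀ A B d → d * (4 * A + 2 * B) * 4 ≡ d * (B * 4 + (2 * (A * 8) + B * 4))
    lhs = solve-∀
    rhs : ∀ A c → c * A * 4 ≡ c * (A * 4)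
    rhs = solve-∀

  headWeight≥1 : ∀ x y → 1 ≤ headWeight x y
  headWeight≥1 (suc _) (suc _) = ≤-trans 1≤B B≤A
  headWeight≥1 zero    _       = 1≤B
  headWeight≥1 (suc _) zero    = 1≤B

  weight≥1 : ∀ {n} (π : Vec (Fin n) n) → 1 ≤ weight π
  weight≥1 {zero}  _ = ≤-refl
  weight≥1 {suc n} π = *-mono-≤ (headWeight≥1 (free π (val π zero)) (free π (suc (val π zero))))
                                (m^n>0 2 (freeGaps π))

  opaque
    valid? : ∀ {n} (π : Vec (Fin n) n) → Dec (IsPerm π × Avoids π)
    valid? π = isPerm? π ×-dec avoids? π

  validWeight : ∀ {n} → Vec (Fin n) n → ℕ
  validWeight π = when (valid? π) (weight π)

  totalWeight : ℕ → ℕ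
  totalWeight n = ∑[ π ∈ allVecs n n ] validWeight π

  opaque
    unfolding valid?
    O≤totalWeight : ∀ n → O n ≤ totalWeight n
    O≤totalWeight n = length-filter≤∑ valid? (allVecs n n) weight weight≥1

  validWeight-repeated : ∀ {m} (x : Fin (suc m)) (v : Vec (Fin (suc m)) m) i →
    lookup v i ≡ x → validWeight (x ∷ v) ≡ 0
  validWeight-repeated x v i vi≡x with valid? (x ∷ v)
  ... | yes (x∷v-perm , _) = contradiction vi≡x (isPerm-∷⇒∉ x∷v-perm i)
  ... | no  _              = refl

  childWeight : ∀ {m} → Vec (Fin m) m → Fin (suc m) → ℕ
  childWeight ρ g = when (valid? ρ) (free ρ (toℕ g) * weight (prepend g ρ))

  validWeight-prepend : ∀ {m} (g : Fin (suc m)) (ρ : Vec (Fin m) m) → validWeight (prepend g ρ) ≤ childWeight ρ g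
  validWeight-prepend g ρ with valid? (prepend g ρ)
  ... | no  _                  = z≤n
  ... | yes (π-perm , π-avoids) with valid? ρ
  ...   | no ¬valid = contradiction (isPerm-prepend⇒isPerm g ρ π-perm , avoids-prepend⇒avoids g ρ π-avoids) ¬valid
  ...   | yes _     = ≤-reflexive (sym (trans
    (cong (_* weight (prepend g ρ)) (free-unblocked ρ (avoids-prepend⇒¬blocked g ρ π-avoids)))
    (*-identityˡ (weight (prepend g ρ)))))

  childWeights≤ : ∀ {m} (ρ : Vec (Fin (suc m)) (suc m)) → d * sum (childWeight ρ) ≤ c * validWeight ρ
  childWeights≤ {m} ρ with valid? ρ
  ... | yes (ρ-perm , _) = childrenWeight≤ ρ ρ-perm B≤A {c} {d} headBudget≤
  ... | no  _            = ≤-reflexive (begin-equality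
    d * sum (λ (_ : Fin (suc (suc m))) → 0) ≡⟨ cong (d *_) (sum-replicate-zero (suc (suc m))) ⟩
    d * 0                                  ≡⟨ *-zeroʳ d ⟩
    0                                      ≡⟨ *-zeroʳ c ⟨
    c * 0                                  ∎)
    where open ≤-Reasoning

  totalWeight-step : ∀ n → d * totalWeight (suc (suc n)) ≤ c * totalWeight (suc n)
  totalWeight-step n = begin
    d * totalWeight (2+n)
      ≡⟨ cong (d *_) (∑-allVecs-suc (2+n) (1+n) validWeight) ⟩
    d * sum (λ x → ∑[ v ∈ allVecs (2+n) (1+n) ] validWeight (x ∷ v))
      ≡⟨ cong (d *_) (sum-cong-≗ λ x → ∑-allVecs-punchIn (1+n) (1+n) x (λ v → validWeight (x ∷ v)) (validWeight-repeated x)) ⟩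
    d * sum (λ x → ∑[ ρ ∈ allVecs (1+n) (1+n) ] validWeight (prepend x ρ))
      ≤⟨ *-monoʳ-≤ d (sum-mono-≤ λ x → ∑-mono-≤ (allVecs (1+n) (1+n)) λ ρ → validWeight-prepend x ρ) ⟩
    d * sum (λ x → ∑[ ρ ∈ allVecs (1+n) (1+n) ] childWeight ρ x)
      ≡⟨ cong (d *_) (sum-∑-comm (allVecs (1+n) (1+n)) λ x ρ → childWeight ρ x) ⟩
    d * ∑[ ρ ∈ allVecs (1+n) (1+n) ] sum (childWeight ρ)
      ≡⟨ ∑-*ˡ (allVecs (1+n) (1+n)) d (λ ρ → sum (childWeight ρ)) ⟨
    ∑[ ρ ∈ allVecs (1+n) (1+n) ] (d * sum (childWeight ρ))
      ≤⟨ ∑-mono-≤ (allVecs (1+n) (1+n)) childWeights≤ ⟩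
    ∑[ ρ ∈ allVecs (1+n) (1+n) ] (c * validWeight ρ)
      ≡⟨ ∑-*ˡ (allVecs (1+n) (1+n)) c validWeight ⟩
    c * totalWeight (1+n) ∎
    where
    open ≤-Reasoning
    1+n : ℕ
    1+n = suc n
    2+n : ℕ
    2+n = suc (suc n)

  totalWeight-growth : ∀ n → d ^ n * totalWeight (suc n) ≤ c ^ n * totalWeight 1
  totalWeight-growth zero    = ≤-refl
  totalWeight-growth (suc n) = begin
    d * d ^ n * totalWeight (suc (suc n))  ≡⟨ xy∙z≈y∙xz d (d ^ n) _ ⟩
    d ^ n * (d * totalWeight (suc (suc n))) ≤⟨ *-monoʳ-≤ (d ^ n) (totalWeight-step n) ⟩
    d ^ n * (c * totalWeight (suc n))       ≡⟨ x∙yz≈y∙xz (d ^ n) c _ ⟩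
    c * (d ^ n * totalWeight (suc n))       ≤⟨ *-monoʳ-≤ c (totalWeight-growth n) ⟩
    c * (c ^ n * totalWeight 1)             ≡⟨ *-assoc c (c ^ n) _ ⟨
    c * c ^ n * totalWeight 1               ∎
    where open ≤-Reasoning

  O-growth : ∀ n → d ^ n * O (suc n) ≤ c ^ n * totalWeight 1
  O-growth n = ≤-trans (*-monoʳ-≤ (d ^ n) (O≤totalWeight (suc n))) (totalWeight-growth n)

certificate : ∀ {c d} → 1 ≤ d → 3 * d ≤ c → 7 * c * d ≤ c * c + 8 * d * d →
  GrowthCertificate (c ∸ 3 * d) (2 * d) c d
certificate {c} {d} 1≤d 3d≤c 7cd≤c²+8d² = record
  { B≤A       = B≤A
  ; 1≤B       = ≤-trans 1≤d (m≤m+n d (d + 0))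
  ; 4d≤c      = 4d≤c
  ; one-free  = ≤-reflexive (trans (one d A) (cong (_* (2 * d)) (sym c≡3d+A)))
  ; both-free = subst₂ _≤_ (both₁ d A) (trans (both₂ d A) (cong (_* A) (sym c≡3d+A)))
                          (+-monoˡ-≤ (3 * d * A) dA+4d²≤A²)
  }
  where
  A : ℕ
  A = c ∸ 3 * d
  c≡3d+A : c ≡ 3 * d + A
  c≡3d+A = sym (m+[n∸m]≡n 3d≤c)
  dA+4d²≤A² : d * A + 4 * d * d ≤ A * A
  dA+4d²≤A² = +-cancelʳ-≤ (17 * d * d + 6 * d * A) (d * A + 4 * d * d) (A * A)
    (subst₂ _≤_ (lhs d A) (rhs d A) (subst (λ x → 7 * x * d ≤ x * x + 8 * d * d) c≡3d+A 7cd≤c²+8d²))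
    where
    lhs : ∀ d A → 7 * (3 * d + A) * d ≡ d * A + 4 * d * d + (17 * d * d + 6 * d * A)
    lhs = solve-∀
    rhs : ∀ d A → (3 * d + A) * (3 * d + A) + 8 * d * d ≡ A * A + (17 * d * d + 6 * d * A)
    rhs = solve-∀
  B≤A : 2 * d ≤ A
  B≤A = ≮⇒≥ λ A<2d → <⇒≱ (<-≤-trans (*-mono-< A<2d A<2d) (≤-reflexive (sq d)))
                          (≤-trans (m≤n+m (4 * d * d) (d * A)) dA+4d²≤A²)
    where
    sq : ∀ d → 2 * d * (2 * d) ≡ 4 * d * d
    sq = solve-∀
  4d≤c : 4 * d ≤ c
  4d≤c = begin
    4 * d      ≡⟨ split d ⟩
    3 * d + d  ≤⟨ +-monoʳ-≤ (3 * d) (≤-trans (m≤m+n d (d + 0)) B≤A) ⟩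
    3 * d + A  ≡⟨ c≡3d+A ⟨
    c          ∎
    where
    open ≤-Reasoning
    split : ∀ d → 4 * d ≡ 3 * d + d
    split = solve-∀
  one : ∀ d A → d * (2 * A + 3 * (2 * d)) ≡ (3 * d + A) * (2 * d)
  one = solve-∀
  both₁ : ∀ d A → d * A + 4 * d * d + 3 * d * A ≡ d * (4 * A + 2 * (2 * d))
  both₁ = solve-∀
  both₂ : ∀ d A → A * A + 3 * d * A ≡ (3 * d + A) * A
  both₂ = solve-∀

aboveBound⇒7ab<a²+8b² : ∀ {a b} → AboveBound a b → 7 * a * b < a * a + 8 * b * b
aboveBound⇒7ab<a²+8b² {a} {b} (_ , 7b<2a , 17b²<e²) =
  *-cancelˡ-< 4 (7 * a * b) (a * a + 8 * b * b)
    (+-cancelʳ-< (17 * b ^ 2) (4 * (7 * a * b)) (4 * (a * a + 8 * b * b)) (begin-strict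
    4 * (7 * a * b) + 17 * b ^ 2          <⟨ +-monoʳ-< (4 * (7 * a * b)) 17b²<e² ⟩
    4 * (7 * a * b) + e ^ 2               ≡⟨ identity ⟨
    4 * (a * a + 8 * b * b) + 17 * b ^ 2  ∎))
  where
  open ≤-Reasoning
  e : ℕ
  e = 2 * a ∸ 7 * b
  e+7b≡2a : e + 7 * b ≡ 2 * a
  e+7b≡2a = m∸n+n≡m (<⇒≤ 7b<2a)
  identity : 4 * (a * a + 8 * b * b) + 17 * b ^ 2 ≡ 4 * (7 * a * b) + e ^ 2
  identity = begin-equality
    4 * (a * a + 8 * b * b) + 17 * b ^ 2      ≡⟨ l₁ a b ⟩
    2 * a * (2 * a) + 49 * (b * b)            ≡⟨ cong (λ x → x * x + 49 * (b * b)) e+7b≡2a ⟨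
    (e + 7 * b) * (e + 7 * b) + 49 * (b * b)  ≡⟨ l₂ e b ⟩
    14 * b * (e + 7 * b) + e ^ 2              ≡⟨ cong (λ x → 14 * b * x + e ^ 2) e+7b≡2a ⟩
    14 * b * (2 * a) + e ^ 2                  ≡⟨ l₃ a b (e ^ 2) ⟩
    4 * (7 * a * b) + e ^ 2                   ∎
    where
    l₁ : ∀ a b → 4 * (a * a + 8 * b * b) + 17 * (b * (b * 1)) ≡ 2 * a * (2 * a) + 49 * (b * b)
    l₁ = solve-∀
    l₂ : ∀ e b → (e + 7 * b) * (e + 7 * b) + 49 * (b * b) ≡ 14 * b * (e + 7 * b) + e * (e * 1)
    l₂ = solve-∀
    l₃ : ∀ a b x → 14 * b * (2 * a) + x ≡ 4 * (7 * a * b) + x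
    l₃ = solve-∀

-- The ratio a/b is approximated from below by c/d = ak/(bk + 1); the choice k = 7a turns
-- the error term 7ak of 7cd into k², which the strict inequality 7ab < a² + 8b² absorbs.
module Scaled (a b : ℕ) where

  k c d : ℕ
  k = 7 * a
  c = a * k
  d = suc (b * k)

  3d≤c : 7 * b < 2 * a → 3 * d ≤ c
  3d≤c 7b<2a = begin
    3 * d            ≡⟨ l₁ (b * k) ⟩
    3 + 3 * (b * k)  ≤⟨ +-monoˡ-≤ (3 * (b * k)) 3≤k ⟩
    k + 3 * (b * k)  ≡⟨ l₂ b k ⟩
    suc (3 * b) * k  ≤⟨ *-monoˡ-≤ k 3b<a ⟩
    c                ∎
    where
    open ≤-Reasoning
    3b<a : 3 * b < a
    3b<a = ≰⇒> λ a≤3b → <⇒≱ 7b<2a (begin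
      2 * a        ≤⟨ *-monoʳ-≤ 2 a≤3b ⟩
      2 * (3 * b)  ≡⟨ l₃ b ⟩
      6 * b        ≤⟨ *-monoˡ-≤ b (n≤1+n 6) ⟩
      7 * b        ∎)
      where
      l₃ : ∀ b → 2 * (3 * b) ≡ 6 * b
      l₃ = solve-∀
    3≤k : 3 ≤ k
    3≤k = ≤-trans (s≤s (s≤s (s≤s z≤n))) (*-monoʳ-≤ 7 (≤-trans (s≤s z≤n) 3b<a))
    l₁ : ∀ x → 3 * suc x ≡ 3 + 3 * x
    l₁ = solve-∀
    l₂ : ∀ b k → k + 3 * (b * k) ≡ suc (3 * b) * k
    l₂ = solve-∀

  7cd≤c²+8d² : 7 * a * b < a * a + 8 * b * b → 7 * c * d ≤ c * c + 8 * d * d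
  7cd≤c²+8d² 7ab<a²+8b² = begin
    7 * c * d                                         ≡⟨ l₁ a b k ⟩
    k * k + 7 * a * b * (k * k)                       ≤⟨ *-monoˡ-≤ (k * k) 7ab<a²+8b² ⟩
    (a * a + 8 * b * b) * (k * k)                     ≤⟨ m≤m+n _ (16 * b * k + 8) ⟩
    (a * a + 8 * b * b) * (k * k) + (16 * b * k + 8)  ≡⟨ l₂ a b k ⟩
    c * c + 8 * d * d                                 ∎
    where
    open ≤-Reasoning
    l₁ : ∀ a b k → 7 * (a * k) * suc (b * k) ≡ 7 * a * k + 7 * a * b * (k * k)
    l₁ = solve-∀
    l₂ : ∀ a b k → (a * a + 8 * b * b) * (k * k) + (16 * b * k + 8) ≡ a * k * (a * k) + 8 * suc (b * k) * suc (b * k)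
    l₂ = solve-∀

bernoulli : ∀ M n → M ^ n * (M + n) ≤ M * suc M ^ n
bernoulli M zero    = ≤-reflexive (trans (+-identityʳ (M + 0)) (trans (+-identityʳ M) (sym (*-identityʳ M))))
bernoulli M (suc n) = begin
  M * M ^ n * (M + suc n)           ≡⟨ l₁ M (M ^ n) n ⟩
  M ^ n * (M * (M + suc n))         ≤⟨ *-monoʳ-≤ (M ^ n) (≤-trans (m≤m+n _ n) (≤-reflexive (l₂ M n))) ⟩
  M ^ n * ((M + n) * suc M)         ≡⟨ *-assoc (M ^ n) (M + n) (suc M) ⟨
  M ^ n * (M + n) * suc M           ≤⟨ *-monoˡ-≤ (suc M) (bernoulli M n) ⟩
  M * suc M ^ n * suc M             ≡⟨ l₃ M (suc M ^ n) ⟩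
  M * (suc M * suc M ^ n)           ∎
  where
  open ≤-Reasoning
  l₁ : ∀ M x n → M * x * (M + suc n) ≡ x * (M * (M + suc n))
  l₁ = solve-∀
  l₂ : ∀ M n → M * (M + suc n) + n ≡ (M + n) * suc M
  l₂ = solve-∀
  l₃ : ∀ M y → M * y * suc M ≡ M * (suc M * y)
  l₃ = solve-∀

powers-dominate : ∀ K M .{{_ : NonZero M}} n → K * M ≤ n → K * M ^ n ≤ suc M ^ n
powers-dominate K M n KM≤n = *-cancelˡ-≤ M (begin
  M * (K * M ^ n)   ≡⟨ l M K (M ^ n) ⟩
  M ^ n * (K * M)   ≤⟨ *-monoʳ-≤ (M ^ n) (≤-trans KM≤n (m≤n+m n M)) ⟩
  M ^ n * (M + n)   ≤⟨ bernoulli M n ⟩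
  M * suc M ^ n     ∎)
  where
  open ≤-Reasoning
  l : ∀ M K x → M * (K * x) ≡ x * (K * M)
  l = solve-∀

^-distribʳ-* : ∀ x y n → (x * y) ^ n ≡ x ^ n * y ^ n
^-distribʳ-* x y zero    = refl
^-distribʳ-* x y (suc n) = trans (cong (x * y *_) (^-distribʳ-* x y n)) (interchange′ x y (x ^ n) (y ^ n))
  where
  interchange′ : ∀ x y u v → x * y * (u * v) ≡ x * u * (y * v)
  interchange′ = solve-∀

eventually-≤ : ∀ (f : ℕ → ℕ) {a b k} K .{{_ : NonZero a}} .{{_ : NonZero (b * k)}} →
  (∀ n → suc (b * k) ^ n * f (suc n) ≤ (a * k) ^ n * K) →
  ∃ λ N → ∀ n → N ≤ n → f n * b ^ n ≤ a ^ n
eventually-≤ f {a} {b} {k} K growth = suc (b * K * M) , bound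
  where
  M : ℕ
  M = b * k
  bound : ∀ n → suc (b * K * M) ≤ n → f n * b ^ n ≤ a ^ n
  bound (suc n) (s≤s bKM≤n) = *-cancelʳ-≤ (f (suc n) * b ^ suc n) (a ^ suc n) (suc M ^ n) {{m^n≢0 (suc M) n}} (begin
    f (suc n) * (b * b ^ n) * suc M ^ n  ≡⟨ l₁ (f (suc n)) b (b ^ n) (suc M ^ n) ⟩
    b * b ^ n * (suc M ^ n * f (suc n))  ≤⟨ *-monoʳ-≤ (b * b ^ n) (growth n) ⟩
    b * b ^ n * ((a * k) ^ n * K)        ≡⟨ cong (λ x → b * b ^ n * (x * K)) (^-distribʳ-* a k n) ⟩
    b * b ^ n * (a ^ n * k ^ n * K)      ≡⟨ l₂ b (b ^ n) (a ^ n) (k ^ n) K ⟩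
    a ^ n * (b * K * (b ^ n * k ^ n))    ≡⟨ cong (λ x → a ^ n * (b * K * x)) (^-distribʳ-* b k n) ⟨
    a ^ n * (b * K * M ^ n)              ≤⟨ *-monoʳ-≤ (a ^ n) (powers-dominate (b * K) M n bKM≤n) ⟩
    a ^ n * suc M ^ n                    ≤⟨ *-monoʳ-≤ (a ^ n) (m≤n*m (suc M ^ n) a) ⟩
    a ^ n * (a * suc M ^ n)              ≡⟨ x∙yz≈y∙xz (a ^ n) a (suc M ^ n) ⟩
    a * (a ^ n * suc M ^ n)              ≡⟨ *-assoc a (a ^ n) (suc M ^ n) ⟨
    a * a ^ n * suc M ^ n                ∎)
    where
    open ≤-Reasoning
    l₁ : ∀ o b x y → o * (b * x) * y ≡ b * x * (y * o)
    l₁ = solve-∀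
    l₂ : ∀ b x u v w → b * x * (u * v * w) ≡ u * (b * w * (x * v))
    l₂ = solve-∀

proposition4p19 : (a b : ℕ) → AboveBound a b →
    ∃ λ N → (n : ℕ) → N ≤ n → O n * b ^ n ≤ a ^ n
proposition4p19 a b a/b-bound@(0<b , 7b<2a , _) = eventually-≤ O (totalWeight 1) O-growth
  where
  open Scaled a b
  open Growth (certificate (s≤s z≤n) (3d≤c 7b<2a) (7cd≤c²+8d² (aboveBound⇒7ab<a²+8b² {a} {b} a/b-bound)))
    using (totalWeight; O-growth)
  instance
    a≢0 : NonZero a
    a≢0 = >-nonZero (*-cancelˡ-< 2 0 a (≤-trans (s≤s z≤n) 7b<2a))
    bk≢0 : NonZero (b * k)
    bk≢0 = m*n≢0 b k {{>-nonZero 0<b}} {{m*n≢0 7 a}}
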